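{- Let $R$ be a commutative ring with identity. Let $G$ be a weighted cactoid digraph on $n$ vertices with blocks $G_1,\dots,G_r$, where $G_i$ is a weighted directed cycle on $n_i\ge2$ vertices $v^{(i)}_0,\dots,v^{(i)}_{n_i-1}$ (indices mod $n_i$) with arcs $(v^{(i)}_k,v^{(i)}_{k+1})$ of weight $w^{(i)}_k\in R$. Suppose each first weight $w_i=\sum_{k=0}^{n_i-1}w^{(i)}_k$ is invertible in $R$, and let $w_i^{(2)}=\sum_{0\le k<l\le n_i-1}w^{(i)}_kw^{(i)}_l$. Let $W_c$ be the distance matrix of $G$, i.e. $(W_c)_{uv}$ is the sum of the arc weights along the unique directed path from $u$ to $v$ in $G$ (and $0$ if $u=v$). For each $i$ define (natural bag) $\lambda_i=w_i^{(2)}/w_i$, vectors $\alpha_i,\beta_i$ indexed by $V(G_i)$ with $(\alpha_i)_{v^{(i)}_k}=w^{(i)}_{k-1}/w_i$ and $(\beta_i)_{v^{(i)}_k}=w^{(i)}_k/w_i$, and $L_i=\frac{1}{w_i}(I-P_i)$ where $P_i$ is the $V(G_i)\times V(G_i)$ matrix with nonzero entries $(P_i)_{v^{(i)}_k,v^{(i)}_{k+1}}=1$. Define $\lambda=\sum_{i=1}^r\lambda_i$, vectors $\alpha,\beta$ indexed by $V(G)$ by $\alpha_v=\sum_{i\in\mathrm{Bl}_G(v)}(\alpha_i)_v-\mathrm{bi}_G(v)+1$, $\beta_v=\sum_{i\in\mathrm{Bl}_G(v)}(\beta_i)_v-\mathrm{bi}_G(v)+1$, and $L=\sum_{i=1}^r\hat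 L_i$, where $(\hat L_i)_{uv}=(L_i)_{uv}$ if $u,v\in V(G_i)$ and $0$ otherwise. Then $\alpha^T\mathbf{j}=1$, $L\mathbf{j}=\mathbf{0}$, $\alpha^TW_c=\lambda\mathbf{j}^T$, $LW_c+I=\beta\mathbf{j}^T$, and $\mathbf{j}^T\beta=1$, $\mathbf{j}^TL=\mathbf{0}$, $W_c\beta=\lambda\mathbf{j}$, $W_cL+I=\mathbf{j}\alpha^T$; in particular $L$ is Laplacian-like. Furthermore, if $\lambda$ is invertible in $R$, then $W_c$ is invertible and $W_c^{ -1}=-L+\lambda^{ -1}\beta\alpha^T$.
   Context: A weighted cactoid digraph is a strongly connected directed graph each of whose blocks is a directed cycle (possibly of length two) whose arcs carry weights in $R$. A cut vertex is a vertex whose deletion disconnects the graph; a block is a strongly connected subgraph on at least two vertices with no cut vertex, maximal with this property. For $v\in V(G)$, $\mathrm{Bl}_G(v)$ is the set of indices $i$ with $v\in V(G_i)$ and $\mathrm{bi}_G(v)=|\mathrm{Bl}_G(v)|$. A square matrix $L$ is Laplacian-like if $L\mathbf{j}=\mathbf{0}$ and $\mathbf{j}^TL=\mathbf{0}$. $\mathbf{j}$ is an all-ones column vector, $I$ an identity matrix, $\mathbf{0}$ a zero matrix/vector, of appropriate sizes; $^T$ is transpose; $1/w_i$ is the inverse of $w_i$ in $R$. -}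

module Defs where

open import Level using (Level; _⊔_) renaming (suc to lsuc)
open import Algebra.Bundles using (CommutativeRing)
open import Data.Nat as ℕ using (ℕ; zero; suc; _≤_; _<ᵇ_)
open import Data.Nat.DivMod using (_mod_)
open import Data.Fin as Fin using (Fin; toℕ)
open import Data.Fin.Properties using (any?) renaming (_≟_ to _≟ᶠ_)
open import Data.Product using (Σ; ∃; ∃₂; _×_; _,_; proj₁; proj₂)
open import Data.Sum using (_⊎_)
open import Data.Unit using (⊤)
open import Data.Bool using (if_then_else_)
open import Data.List using (List; []; _∷_)
open import Data.List.Relation.Unary.Unique.Propositional using (Unique)
open import Relation.Nullary using (¬_; Dec; yes; no)
open import Relation.Binary.PropositionalEquality using (_≡_; _≢_)

csuc : ∀ {m} → Fin m → Fin m
csuc {suc m} k = suc (toℕ k) mod suc m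

cpred : ∀ {m} → Fin m → Fin m
cpred {suc m} k = (toℕ k ℕ.+ m) mod suc m

data Reach {n : ℕ} (A : Fin n → Fin n → Set) : Fin n → Fin n → Set where
  here : ∀ {u} → Reach A u u
  step : ∀ {u w v} → A u w → Reach A w v → Reach A u v

module Digraph {n : ℕ} (Arc : Fin n → Fin n → Set) where

  record Subgraph : Set₁ where
    field
      V : Fin n → Set
      A : Fin n → Fin n → Set
      A⊆Arc : ∀ {u v} → A u v → Arc u v
      A⊆V : ∀ {u v} → A u v → V u × V v
  open Subgraph public

  _⊆_ : Subgraph → Subgraph → Set
  H ⊆ H' = (∀ v → V H v → V H' v) × (∀ u v → A H u v → A H' u v)

  _≅_ : Subgraph → Subgraph → Set
  H ≅ H' = H ⊆ H' × H' ⊆ H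

  whole : Subgraph
  whole = record { V = λ _ → ⊤ ; A = Arc ; A⊆Arc = λ a → a ; A⊆V = λ _ → _ , _ }

  StronglyConnected : Subgraph → Set
  StronglyConnected H = ∀ u v → V H u → V H v → Reach (A H) u v

  WeaklyConnected : Subgraph → Set
  WeaklyConnected H = ∀ u v → V H u → V H v → Reach (λ x y → A H x y ⊎ A H y x) u v

  delete : Subgraph → Fin n → Subgraph
  delete H x = record
    { V = λ u → V H u × u ≢ x
    ; A = λ u v → A H u v × u ≢ x × v ≢ x
    ; A⊆Arc = λ { (a , _ , _) → A⊆Arc H a }
    ; A⊆V = λ { (a , p , q) → (proj₁ (A⊆V H a) , p) , (proj₂ (A⊆V H a) , q) }
    }

  CutVertex : Subgraph → Fin n → Set
  CutVertex H x = V H x × ¬ WeaklyConnected (delete H x)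

  AtLeastTwoVertices : Subgraph → Set
  AtLeastTwoVertices H = ∃₂ λ u v → V H u × V H v × u ≢ v

  BlockLike : Subgraph → Set
  BlockLike H = StronglyConnected H × AtLeastTwoVertices H × (∀ x → ¬ CutVertex H x)

  IsBlock : Subgraph → Set₁
  IsBlock H = BlockLike H × (∀ H' → BlockLike H' → H ⊆ H' → H' ⊆ H)

module Cactoid {c ℓ} (R : CommutativeRing c ℓ) where
  open CommutativeRing R

  Σ[_] : ∀ m → (Fin m → Carrier) → Carrier
  Σ[ zero ] f = 0#
  Σ[ suc m ] f = f Fin.zero + Σ[ m ] (λ k → f (Fin.suc k))

  -- Data of a digraph on vertex set Fin n given as a list of r weighted
  -- directed cycles G_i : v^(i)_0 → v^(i)_1 → … → v^(i)_{n_i-1} → v^(i)_0,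
  -- the arc (v^(i)_k , v^(i)_{k+1}) having weight w^(i)_k.
  record WeightedCycles (n : ℕ) : Set c where
    field
      r : ℕ
      size : Fin r → ℕ
      size≥2 : ∀ i → 2 ≤ size i
      vert : (i : Fin r) → Fin (size i) → Fin n
      vert-inj : ∀ i {k l} → vert i k ≡ vert i l → k ≡ l
      wt : (i : Fin r) → Fin (size i) → Carrier

  module _ {n : ℕ} (D : WeightedCycles n) where
    open WeightedCycles D

    Arc : Fin n → Fin n → Set
    Arc u v = Σ (Fin r) λ i → Σ (Fin (size i)) λ k → vert i k ≡ u × vert i (csuc k) ≡ v

    open Digraph Arc

    cycleSub : Fin r → Subgraph
    cycleSub i = record
      { V = λ x → Σ (Fin (size i)) λ k → vert i k ≡ x
      ; A = λ u v → Σ (Fin (size i)) λ k → vert i k ≡ u × vert i (csuc k) ≡ v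
      ; A⊆Arc = λ { (k , p , q) → i , k , p , q }
      ; A⊆V = λ { (k , p , q) → (k , p) , (csuc k , q) }
      }

    IsCactoidWithBlocks : Set₁
    IsCactoidWithBlocks =
      StronglyConnected whole
      × (∀ i → IsBlock (cycleSub i))
      × (∀ H → IsBlock H → Σ (Fin r) λ i → H ≅ cycleSub i)
      × (∀ i j → cycleSub i ≅ cycleSub j → i ≡ j)

    data Walk : Fin n → Fin n → Set where
      [] : ∀ {u} → Walk u u
      _∷_ : ∀ {v} (ik : Σ (Fin r) λ i → Fin (size i))
            → Walk (vert (proj₁ ik) (csuc (proj₂ ik))) v
            → Walk (vert (proj₁ ik) (proj₂ ik)) v

    walkVertices : ∀ {u v} → Walk u v → List (Fin n)
    walkVertices {u} [] = u ∷ []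
    walkVertices (ik ∷ p) = vert (proj₁ ik) (proj₂ ik) ∷ walkVertices p

    walkWeight : ∀ {u v} → Walk u v → Carrier
    walkWeight [] = 0#
    walkWeight (ik ∷ p) = wt (proj₁ ik) (proj₂ ik) + walkWeight p

    IsPath : ∀ {u v} → Walk u v → Set
    IsPath p = Unique (walkVertices p)

    IsDistanceMatrix : (Fin n → Fin n → Carrier) → Set (ℓ)
    IsDistanceMatrix W = ∀ u v (p : Walk u v) → IsPath p → W u v ≈ walkWeight p

    w₁ : Fin r → Carrier
    w₁ i = Σ[ size i ] (wt i)

    w₂ : Fin r → Carrier
    w₂ i = Σ[ size i ] λ k → Σ[ size i ] λ l →
             if toℕ k <ᵇ toℕ l then wt i k * wt i l else 0#

    module _ (inv : Fin r → Carrier) where  -- inv i = 1 / w_i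

      λᵢ : Fin r → Carrier
      λᵢ i = w₂ i * inv i

      λ′ : Carrier
      λ′ = Σ[ r ] λᵢ

      αᵢ βᵢ : (i : Fin r) → Fin (size i) → Carrier
      αᵢ i k = wt i (cpred k) * inv i
      βᵢ i k = wt i k * inv i

      Lᵢ : (i : Fin r) → Fin (size i) → Fin (size i) → Carrier
      Lᵢ i k l = inv i * ((if ⌊ k ≟ᶠ l ⌋′ then 1# else 0#)
                         - (if ⌊ l ≟ᶠ csuc k ⌋′ then 1# else 0#))
        where
          ⌊_⌋′ : ∀ {P : Set} → Dec P → _
          ⌊ yes _ ⌋′ = Data.Bool.true
          ⌊ no _ ⌋′ = Data.Bool.false

      atVertex : (i : Fin r) → (Fin (size i) → Carrier) → Carrier → Fin n → Carrier
      atVertex i f d v with any? (λ k → vert i k ≟ᶠ v)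
      ... | yes (k , _) = f k
      ... | no _ = d

      biR : Fin n → Carrier
      biR v = Σ[ r ] λ i → atVertex i (λ _ → 1#) 0# v

      α β : Fin n → Carrier
      α v = Σ[ r ] (λ i → atVertex i (αᵢ i) 0# v) - biR v + 1#
      β v = Σ[ r ] (λ i → atVertex i (βᵢ i) 0# v) - biR v + 1#

      L : Fin n → Fin n → Carrier
      L u v = Σ[ r ] λ i → atVertex i (λ k → atVertex i (Lᵢ i k) 0# v) 0# u

  module _ {n : ℕ} where
    _⊗_ : (Fin n → Fin n → Carrier) → (Fin n → Fin n → Carrier) → Fin n → Fin n → Carrier
    (M ⊗ N) u v = Σ[ n ] λ x → M u x * N x v

    Id : Fin n → Fin n → Carrier
    Id u v with u ≟ᶠ v
    ... | yes _ = 1#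
    ... | no _ = 0#

    LaplacianLike : (Fin n → Fin n → Carrier) → Set ℓ
    LaplacianLike M = (∀ u → Σ[ n ] (λ v → M u v) ≈ 0#) × (∀ v → Σ[ n ] (λ u → M u v) ≈ 0#)

-- Write L = Σᵢ L̂ᵢ.  Row vᵢₖ of L̂ᵢ takes a vector g to (g vᵢₖ − g vᵢₖ₊₁)/wᵢ.  For g = W(·, v) the difference is read
-- off the vᵢₖ–v path: if it leaves vᵢₖ along Gᵢ it is wᵢₖ; otherwise going around Gᵢ from vᵢₖ₊₁ to vᵢₖ and then along
-- the path is again a path, and it is wᵢₖ − wᵢ.  Since the u–v path leaves u along exactly one block unless u = v,
-- summing over blocks gives L W + I = β jᵀ; dually, with the block along which the path enters v, W L + I = j αᵀ.
-- For W β = λ j: if the path from u reaches Gᵢ at vᵢₑ, then W(u, vᵢ,ₑ₊ₜ) = W(u, vᵢₑ) + wᵢₑ + ⋯ + wᵢ,ₑ₊ₜ₋₁, and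
-- pairing these distances with the weights of Gᵢ leaves the second elementary symmetric function wᵢ⁽²⁾ of them.
-- The remaining identities and the inverse are matrix algebra.  The graph theory behind "is again a path" is that a
-- path between two vertices of a block stays in it: added as an ear, it keeps the block strongly connected without
-- cut vertices, so maximality applies.

module Submission where

open import Defs
open import Algebra.Bundles using (CommutativeRing)
import Algebra.Properties.Ring as RingProperties
import Algebra.Properties.Semiring.Sum as SemiringSum
open import Data.Bool.Base using (if_then_else_)
open import Data.Empty using (⊥-elim)
open import Data.Fin.Base as Fin using (Fin; toℕ)
open import Data.Fin.Properties using (any?; toℕ-injective; toℕ<n; toℕ-fromℕ<; suc-injective) renaming (_≟_ to _≟ᶠ_)
open import Data.List.Base using (List; []; _∷_; _++_; [_])
open import Data.List.Membership.Propositional using (_∈_)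
open import Data.List.Relation.Binary.Disjoint.Propositional using (Disjoint)
open import Data.List.Relation.Unary.All as All using (All; []; _∷_)
open import Data.List.Relation.Unary.All.Properties using (¬Any⇒All¬; ++⁻ˡ; ++⁻ʳ)
open import Data.List.Relation.Unary.AllPairs using ([]; _∷_)
open import Data.List.Relation.Unary.Any using (here; there)
open import Data.List.Relation.Unary.Unique.Propositional using (Unique)
import Data.List.Relation.Unary.Unique.Propositional.Properties as Unique
open import Data.Maybe.Base using (Maybe; just; nothing; _<∣>_)
open import Data.Maybe.Properties using (just-injective) renaming (≡-dec to ≡-decᴹ)
open import Data.Nat.Base using (ℕ; zero; suc; pred; _<_; _≤_; z≤n; s≤s; _<ᵇ_)
open import Data.Nat.Properties using (_<?_; ≤-refl; ≤-trans; <-trans; <-irrefl; ≤-<-trans; ≤-antisym; ≮⇒≥; ≤∧≢⇒<; <⇒≤; n≤1+n)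
open import Data.Product.Base using (Σ; _×_; _,_; proj₁; proj₂)
open import Data.Sum.Base using (_⊎_; inj₁; inj₂)
open import Data.Unit.Base using (tt)
open import Function.Base using (_∘_)
open import Relation.Nullary using (¬_; ¬?; Dec; yes; no)
open import Relation.Nullary.Decidable using (decidable-stable)
open import Relation.Binary.Definitions using (DecidableEquality)
open import Relation.Binary.PropositionalEquality as ≡ using (_≡_; _≢_; module ≡-Reasoning)

module CyclicIndices where
  open import Data.Nat.Base using (NonZero; _+_; _∸_; _%_)
  open import Data.Nat.DivMod using (%-distribˡ-+; m%n%n≡m%n; [m+n]%n≡m%n; m<n⇒m%n≡m; m%n<n)
  open import Data.Nat.GeneralisedArithmetic using (iterate)
  import Data.Nat.Properties as ℕ

  infixl 6 _⊕_

  _⊕_ : ∀ {m} → Fin m → ℕ → Fin m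
  k ⊕ t = iterate csuc k t

  module _ (d : ℕ) .{{_ : NonZero d}} where
    open ≡-Reasoning

    [m%d+n]%d≡[m+n]%d : ∀ a b → (a % d + b) % d ≡ (a + b) % d
    [m%d+n]%d≡[m+n]%d a b = begin
      (a % d + b) % d           ≡⟨ %-distribˡ-+ (a % d) b d ⟩
      (a % d % d + b % d) % d   ≡⟨ ≡.cong (λ x → (x + b % d) % d) (m%n%n≡m%n a d) ⟩
      (a % d + b % d) % d       ≡⟨ %-distribˡ-+ a b d ⟨
      (a + b) % d               ∎

    [m+n%d]%d≡[m+n]%d : ∀ a b → (a + b % d) % d ≡ (a + b) % d
    [m+n%d]%d≡[m+n]%d a b = begin
      (a + b % d) % d   ≡⟨ ≡.cong (_% d) (ℕ.+-comm a (b % d)) ⟩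
      (b % d + a) % d   ≡⟨ [m%d+n]%d≡[m+n]%d b a ⟩
      (b + a) % d       ≡⟨ ≡.cong (_% d) (ℕ.+-comm b a) ⟩
      (a + b) % d       ∎

    [m+d]%d≡m : ∀ {a} → a < d → (a + d) % d ≡ a
    [m+d]%d≡m {a} a<d = ≡.trans ([m+n]%n≡m%n a d) (m<n⇒m%n≡m a<d)

  ⊕-suc : ∀ {m} (k : Fin m) t → k ⊕ suc t ≡ csuc (k ⊕ t)
  ⊕-suc k zero    = ≡.refl
  ⊕-suc k (suc t) = ⊕-suc (csuc k) t

  toℕ-⊕ : ∀ {M} (k : Fin (suc M)) t → toℕ (k ⊕ t) ≡ (toℕ k + t) % suc M
  toℕ-⊕ {M} k zero = ≡.sym (≡.trans (≡.cong (_% suc M) (ℕ.+-identityʳ (toℕ k))) (m<n⇒m%n≡m (toℕ<n k)))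
  toℕ-⊕ {M} k (suc t) = begin
    toℕ (csuc k ⊕ t)                   ≡⟨ toℕ-⊕ (csuc k) t ⟩
    (toℕ (csuc k) + t) % suc M         ≡⟨ ≡.cong (λ x → (x + t) % suc M) (toℕ-fromℕ< (m%n<n (suc (toℕ k)) (suc M))) ⟩
    (suc (toℕ k) % suc M + t) % suc M  ≡⟨ [m%d+n]%d≡[m+n]%d (suc M) (suc (toℕ k)) t ⟩
    (suc (toℕ k) + t) % suc M          ≡⟨ ≡.cong (_% suc M) (ℕ.+-suc (toℕ k) t) ⟨
    (toℕ k + suc t) % suc M            ∎
    where open ≡-Reasoning

  ⊕-period : ∀ {m} (k : Fin m) → k ⊕ m ≡ k
  ⊕-period {suc M} k = toℕ-injective (≡.trans (toℕ-⊕ k (suc M)) ([m+d]%d≡m (suc M) (toℕ<n k)))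

  zero⊕toℕ : ∀ {M} (l : Fin (suc M)) → Fin.zero ⊕ toℕ l ≡ l
  zero⊕toℕ {M} l = toℕ-injective (≡.trans (toℕ-⊕ Fin.zero (toℕ l)) (m<n⇒m%n≡m (toℕ<n l)))

  cpred≡⊕pred : ∀ {m} (k : Fin m) → cpred k ≡ k ⊕ pred m
  cpred≡⊕pred {suc M} k = toℕ-injective (≡.trans (toℕ-fromℕ< _) (≡.sym (toℕ-⊕ k M)))

  csuc-cpred : ∀ {m} (k : Fin m) → csuc (cpred k) ≡ k
  csuc-cpred {suc M} k = ≡.trans (≡.cong csuc (cpred≡⊕pred k)) (≡.trans (≡.sym (⊕-suc k M)) (⊕-period k))

  cpred-csuc : ∀ {m} (k : Fin m) → cpred (csuc k) ≡ k
  cpred-csuc {suc M} k = ≡.trans (cpred≡⊕pred (csuc k)) (⊕-period k)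

  offset : ∀ {m} → Fin m → Fin m → ℕ
  offset {suc M} k l = (toℕ l + (suc M ∸ toℕ k)) % suc M

  offset<m : ∀ {m} (k l : Fin m) → offset k l < m
  offset<m {suc M} k l = m%n<n (toℕ l + (suc M ∸ toℕ k)) (suc M)

  ⊕-offset : ∀ {m} (k l : Fin m) → k ⊕ offset k l ≡ l
  ⊕-offset {suc M} k l = toℕ-injective (begin
    toℕ (k ⊕ offset k l)                              ≡⟨ toℕ-⊕ k (offset k l) ⟩
    (toℕ k + (toℕ l + (m ∸ toℕ k)) % m) % m           ≡⟨ [m+n%d]%d≡[m+n]%d m (toℕ k) _ ⟩
    (toℕ k + (toℕ l + (m ∸ toℕ k))) % m               ≡⟨ ≡.cong (_% m) (x+[y+[m∸x]]≡y+m (toℕ l) (toℕ<n k)) ⟩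
    (toℕ l + m) % m                                   ≡⟨ [m+d]%d≡m m (toℕ<n l) ⟩
    toℕ l                                             ∎)
    where
    open ≡-Reasoning
    m = suc M
    x+[y+[m∸x]]≡y+m : ∀ {x} y → x < m → x + (y + (m ∸ x)) ≡ y + m
    x+[y+[m∸x]]≡y+m {x} y x<m = ≡.trans (ℕ.+-comm x _) (≡.trans (ℕ.+-assoc y _ x) (≡.cong (y +_) (ℕ.m∸n+n≡m (<⇒≤ x<m))))

  offset-⊕ : ∀ {m} (k : Fin m) {t} → t < m → offset k (k ⊕ t) ≡ t
  offset-⊕ {suc M} k {t} t<m = begin
    (toℕ (k ⊕ t) + (m ∸ toℕ k)) % m          ≡⟨ ≡.cong (λ x → (x + (m ∸ toℕ k)) % m) (toℕ-⊕ k t) ⟩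
    ((toℕ k + t) % m + (m ∸ toℕ k)) % m      ≡⟨ [m%d+n]%d≡[m+n]%d m (toℕ k + t) _ ⟩
    (toℕ k + t + (m ∸ toℕ k)) % m            ≡⟨ ≡.cong (_% m) (x+y+[m∸x]≡y+m (toℕ<n k)) ⟩
    (t + m) % m                              ≡⟨ [m+d]%d≡m m t<m ⟩
    t                                        ∎
    where
    open ≡-Reasoning
    m = suc M
    x+y+[m∸x]≡y+m : ∀ {x} → x < m → x + t + (m ∸ x) ≡ t + m
    x+y+[m∸x]≡y+m {x} x<m = ≡.trans (≡.cong (_+ (m ∸ x)) (ℕ.+-comm x t)) (≡.trans (ℕ.+-assoc t x _) (≡.cong (t +_) (ℕ.m+[n∸m]≡n (<⇒≤ x<m))))

  ⊕-injective : ∀ {m} (k : Fin m) {s t} → s < m → t < m → k ⊕ s ≡ k ⊕ t → s ≡ t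
  ⊕-injective k s<m t<m e = ≡.trans (≡.sym (offset-⊕ k s<m)) (≡.trans (≡.cong (offset k) e) (offset-⊕ k t<m))

  csuc≢id : ∀ {m} → 2 ≤ m → (k : Fin m) → csuc k ≢ k
  csuc≢id 2≤m k e with ⊕-injective k 2≤m (≤-trans (s≤s z≤n) 2≤m) e
  ... | ()

  csuc⊕pred : ∀ {m} (k : Fin m) → csuc k ⊕ pred m ≡ k
  csuc⊕pred {suc M} k = ⊕-period k

  pred<m : ∀ {m} → Fin m → pred m < m
  pred<m {suc M} _ = ≤-refl

open CyclicIndices

module _ {a} {A : Set a} where

  unique-++⁻ˡ : ∀ xs {ys : List A} → Unique (xs ++ ys) → Unique xs
  unique-++⁻ˡ []       _        = []
  unique-++⁻ˡ (x ∷ xs) (x∉ ∷ u) = ++⁻ˡ xs x∉ ∷ unique-++⁻ˡ xs u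

  unique-++⁻ʳ : ∀ xs {ys : List A} → Unique (xs ++ ys) → Unique ys
  unique-++⁻ʳ []       u       = u
  unique-++⁻ʳ (x ∷ xs) (_ ∷ u) = unique-++⁻ʳ xs u

  unique-++⇒disjoint : ∀ xs {ys : List A} → Unique (xs ++ ys) → Disjoint xs ys
  unique-++⇒disjoint (x ∷ xs) (x∉ ∷ _) (here ≡.refl , y∈) = All.lookup (++⁻ʳ xs x∉) y∈ ≡.refl
  unique-++⇒disjoint (x ∷ xs) (_ ∷ u)  (there y∈ , y∈′)  = unique-++⇒disjoint xs u (y∈ , y∈′)

module _ {n : ℕ} {A : Fin n → Fin n → Set} where

  Reach-trans : ∀ {a b c} → Reach A a b → Reach A b c → Reach A a c
  Reach-trans here        r′ = r′
  Reach-trans (step e r) r′ = step e (Reach-trans r r′)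

  Reach-∷ʳ : ∀ {a b c} → Reach A a b → A b c → Reach A a c
  Reach-∷ʳ r e = Reach-trans r (step e here)

  Reach-reverse : (∀ {a b} → A a b → A b a) → ∀ {a b} → Reach A a b → Reach A b a
  Reach-reverse sym here       = here
  Reach-reverse sym (step e r) = Reach-∷ʳ (Reach-reverse sym r) (sym e)

  Reach-map : ∀ {B : Fin n → Fin n → Set} → (∀ {a b} → A a b → B a b) → ∀ {a b} → Reach A a b → Reach B a b
  Reach-map f here       = here
  Reach-map f (step e r) = step (f e) (Reach-map f r)

module Sums {c ℓ} (R : CommutativeRing c ℓ) where
  open CommutativeRing R
  open Cactoid R using (Σ[_])
  open RingProperties ring using (-‿+-comm; -0#≈0#; quasigroup)
  open import Algebra.Properties.Quasigroup quasigroup using () renaming (cancelʳ to +-cancelʳ)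
  open SemiringSum semiring using (sum; sum-cong-≋; ∑-distrib-+; ∑-comm; *-distribˡ-sum; sum-replicate-zero)
  open import Relation.Binary.Reasoning.Setoid setoid

  Σ≡sum : ∀ m (f : Fin m → Carrier) → Σ[ m ] f ≡ sum f
  Σ≡sum zero    f = ≡.refl
  Σ≡sum (suc m) f = ≡.cong (f Fin.zero +_) (Σ≡sum m (λ k → f (Fin.suc k)))

  Σ-cong : ∀ m {f g : Fin m → Carrier} → (∀ k → f k ≈ g k) → Σ[ m ] f ≈ Σ[ m ] g
  Σ-cong m {f} {g} f≈g = begin
    Σ[ m ] f  ≡⟨ Σ≡sum m f ⟩
    sum f     ≈⟨ sum-cong-≋ f≈g ⟩
    sum g     ≡⟨ Σ≡sum m g ⟨
    Σ[ m ] g  ∎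

  Σ-zero : ∀ m → Σ[ m ] (λ _ → 0#) ≈ 0#
  Σ-zero m = trans (reflexive (Σ≡sum m _)) (sum-replicate-zero m)

  Σ-+ : ∀ m (f g : Fin m → Carrier) → Σ[ m ] (λ k → f k + g k) ≈ Σ[ m ] f + Σ[ m ] g
  Σ-+ m f g = begin
    Σ[ m ] (λ k → f k + g k)  ≡⟨ Σ≡sum m _ ⟩
    sum (λ k → f k + g k)     ≈⟨ ∑-distrib-+ f g ⟩
    sum f + sum g             ≡⟨ ≡.cong₂ _+_ (Σ≡sum m f) (Σ≡sum m g) ⟨
    Σ[ m ] f + Σ[ m ] g       ∎

  *-distribˡ-Σ : ∀ m a (f : Fin m → Carrier) → a * Σ[ m ] f ≈ Σ[ m ] (λ k → a * f k)
  *-distribˡ-Σ m a f = begin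
    a * Σ[ m ] f            ≡⟨ ≡.cong (a *_) (Σ≡sum m f) ⟩
    a * sum f               ≈⟨ *-distribˡ-sum a f ⟩
    sum (λ k → a * f k)     ≡⟨ Σ≡sum m _ ⟨
    Σ[ m ] (λ k → a * f k)  ∎

  *-distribʳ-Σ : ∀ m a (f : Fin m → Carrier) → Σ[ m ] f * a ≈ Σ[ m ] (λ k → f k * a)
  *-distribʳ-Σ m a f = trans (*-comm _ a) (trans (*-distribˡ-Σ m a f) (Σ-cong m (λ k → *-comm a (f k))))

  Σ-comm : ∀ m p (f : Fin m → Fin p → Carrier) →
           Σ[ m ] (λ k → Σ[ p ] (f k)) ≈ Σ[ p ] (λ l → Σ[ m ] (λ k → f k l))
  Σ-comm m p f = begin
    Σ[ m ] (λ k → Σ[ p ] (f k))              ≈⟨ Σ-cong m (λ k → reflexive (Σ≡sum p (f k))) ⟩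
    Σ[ m ] (λ k → sum (f k))                 ≡⟨ Σ≡sum m _ ⟩
    sum (λ k → sum (f k))                    ≈⟨ ∑-comm f ⟩
    sum (λ l → sum (λ k → f k l))            ≡⟨ Σ≡sum p _ ⟨
    Σ[ p ] (λ l → sum (λ k → f k l))         ≈⟨ Σ-cong p (λ l → reflexive (Σ≡sum m _)) ⟨
    Σ[ p ] (λ l → Σ[ m ] (λ k → f k l))      ∎

  Σ-neg : ∀ m (f : Fin m → Carrier) → Σ[ m ] (λ k → - f k) ≈ - Σ[ m ] f
  Σ-neg zero    f = sym -0#≈0#
  Σ-neg (suc m) f = trans (+-congˡ (Σ-neg m _)) (-‿+-comm _ _)

  Σ-sub : ∀ m (f g : Fin m → Carrier) → Σ[ m ] (λ k → f k - g k) ≈ Σ[ m ] f - Σ[ m ] g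
  Σ-sub m f g = trans (Σ-+ m f (λ k → - g k)) (+-congˡ (Σ-neg m g))

  χ : ∀ {p} {P : Set p} → Dec P → Carrier
  χ (yes _) = 1#
  χ (no _)  = 0#

  χ-cong : ∀ {p q} {P : Set p} {Q : Set q} (P? : Dec P) (Q? : Dec Q) → (P → Q) → (Q → P) → χ P? ≈ χ Q?
  χ-cong (yes _) (yes _) _   _   = refl
  χ-cong (no _)  (no _)  _   _   = refl
  χ-cong (yes p) (no ¬q) P⇒Q _   = ⊥-elim (¬q (P⇒Q p))
  χ-cong (no ¬p) (yes q) _   Q⇒P = ⊥-elim (¬p (Q⇒P q))

  Σ-δ : ∀ m (a : Fin m) (f : Fin m → Carrier) → Σ[ m ] (λ l → χ (a ≟ᶠ l) * f l) ≈ f a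
  Σ-δ (suc m) Fin.zero    f = begin
    1# * f Fin.zero + Σ[ m ] (λ l → 0# * f (Fin.suc l))  ≈⟨ +-cong (*-identityˡ _) (Σ-cong m (λ l → zeroˡ _)) ⟩
    f Fin.zero + Σ[ m ] (λ _ → 0#)                       ≈⟨ +-congˡ (Σ-zero m) ⟩
    f Fin.zero + 0#                                      ≈⟨ +-identityʳ _ ⟩
    f Fin.zero                                           ∎
  Σ-δ (suc m) (Fin.suc a) f = begin
    0# * f Fin.zero + Σ[ m ] (λ l → χ (Fin.suc a ≟ᶠ Fin.suc l) * f (Fin.suc l))
      ≈⟨ +-cong (zeroˡ _) (Σ-cong m (λ l → *-congʳ (χ-cong (Fin.suc a ≟ᶠ Fin.suc l) (a ≟ᶠ l) suc-injective (≡.cong Fin.suc)))) ⟩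
    0# + Σ[ m ] (λ l → χ (a ≟ᶠ l) * f (Fin.suc l))
      ≈⟨ +-identityˡ _ ⟩
    Σ[ m ] (λ l → χ (a ≟ᶠ l) * f (Fin.suc l))
      ≈⟨ Σ-δ m a (λ l → f (Fin.suc l)) ⟩
    f (Fin.suc a)
      ∎

  Σ-δ′ : ∀ m (a : Fin m) (f : Fin m → Carrier) → Σ[ m ] (λ l → χ (l ≟ᶠ a) * f l) ≈ f a
  Σ-δ′ m a f = trans (Σ-cong m (λ l → *-congʳ (χ-cong (l ≟ᶠ a) (a ≟ᶠ l) ≡.sym ≡.sym))) (Σ-δ m a f)

  Σ<[_] : ℕ → (ℕ → Carrier) → Carrier
  Σ<[ t ] G = Σ[ t ] (λ s → G (toℕ s))

  Σ<-cong : ∀ t {G H : ℕ → Carrier} → (∀ s → s < t → G s ≈ H s) → Σ<[ t ] G ≈ Σ<[ t ] H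
  Σ<-cong t G≈H = Σ-cong t (λ s → G≈H (toℕ s) (toℕ<n s))

  Σ<-snoc : ∀ t (G : ℕ → Carrier) → Σ<[ suc t ] G ≈ Σ<[ t ] G + G t
  Σ<-snoc zero    G = trans (+-identityʳ _) (sym (+-identityˡ _))
  Σ<-snoc (suc t) G = trans (+-congˡ (Σ<-snoc t (λ s → G (suc s)))) (sym (+-assoc _ _ _))

  Σ<-shift : ∀ m (G : ℕ → Carrier) → G m ≈ G 0 → Σ<[ m ] (λ s → G (suc s)) ≈ Σ<[ m ] G
  Σ<-shift m G Gm≈G0 = +-cancelʳ (G 0) _ _ (begin
    Σ<[ m ] (λ s → G (suc s)) + G 0  ≈⟨ +-comm _ _ ⟩
    Σ<[ suc m ] G                    ≈⟨ Σ<-snoc m G ⟩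
    Σ<[ m ] G + G m                  ≈⟨ +-congˡ Gm≈G0 ⟩
    Σ<[ m ] G + G 0                  ∎)

  e₂ : ℕ → (ℕ → Carrier) → Carrier
  e₂ m G = Σ<[ m ] (λ t → Σ<[ t ] G * G t)

  e₂-shift : ∀ m (G : ℕ → Carrier) → G m ≈ G 0 → e₂ m (λ s → G (suc s)) ≈ e₂ m G
  e₂-shift m G Gm≈G0 = +-cancelʳ (G 0 * Σ<[ m ] G) _ _ (begin
    e₂ m G′ + G 0 * Σ<[ m ] G                             ≈⟨ +-comm _ _ ⟩
    G 0 * Σ<[ m ] G + e₂ m G′                             ≈⟨ +-congʳ (*-congˡ (Σ<-shift m G Gm≈G0)) ⟨
    G 0 * Σ<[ m ] G′ + e₂ m G′                            ≈⟨ +-congʳ (*-distribˡ-Σ m (G 0) _) ⟩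
    Σ<[ m ] (λ s → G 0 * G′ s) + e₂ m G′                  ≈⟨ Σ-+ m _ _ ⟨
    Σ<[ m ] (λ s → G 0 * G′ s + Σ<[ s ] G′ * G′ s)        ≈⟨ Σ<-cong m (λ s _ → distribʳ (G′ s) (G 0) (Σ<[ s ] G′)) ⟨
    Σ<[ m ] (λ s → Σ<[ suc s ] G * G′ s)                  ≈⟨ +-identityˡ _ ⟨
    0# + Σ<[ m ] (λ s → Σ<[ suc s ] G * G′ s)             ≈⟨ +-congʳ (zeroˡ (G 0)) ⟨
    e₂ (suc m) G                                          ≈⟨ Σ<-snoc m (λ t → Σ<[ t ] G * G t) ⟩
    e₂ m G + Σ<[ m ] G * G m                              ≈⟨ +-congˡ (trans (*-congˡ Gm≈G0) (*-comm _ _)) ⟩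
    e₂ m G + G 0 * Σ<[ m ] G                              ∎)
    where G′ = λ s → G (suc s)

  orbit-invariant : ∀ {M} (f : Fin (suc M) → Carrier) (Φ : (ℕ → Carrier) → Carrier) →
                    (∀ k → Φ (λ t → f (csuc k ⊕ t)) ≈ Φ (λ t → f (k ⊕ t))) →
                    ∀ k → Φ (λ t → f (k ⊕ t)) ≈ Φ (λ t → f (Fin.zero ⊕ t))
  orbit-invariant f Φ rotate k =
    trans (reflexive (≡.cong (λ x → Φ (λ t → f (x ⊕ t))) (≡.sym (zero⊕toℕ k)))) (from-zero (toℕ k))
    where
    from-zero : ∀ j → Φ (λ t → f (Fin.zero ⊕ j ⊕ t)) ≈ Φ (λ t → f (Fin.zero ⊕ t))
    from-zero zero    = refl
    from-zero (suc j) = trans (reflexive (≡.cong (λ x → Φ (λ t → f (x ⊕ t))) (⊕-suc Fin.zero j)))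
                              (trans (rotate (Fin.zero ⊕ j)) (from-zero j))

  Σ-orbit : ∀ {m} (f : Fin m → Carrier) k → Σ<[ m ] (λ t → f (k ⊕ t)) ≈ Σ[ m ] f
  Σ-orbit {suc M} f k = trans (orbit-invariant f Σ<[ suc M ] shift k)
                              (Σ-cong (suc M) (λ l → reflexive (≡.cong f (zero⊕toℕ l))))
    where
    shift : ∀ k → Σ<[ suc M ] (λ t → f (csuc k ⊕ t)) ≈ Σ<[ suc M ] (λ t → f (k ⊕ t))
    shift k = Σ<-shift (suc M) (λ t → f (k ⊕ t)) (reflexive (≡.cong f (⊕-period k)))

  Σ-csuc : ∀ m (f : Fin m → Carrier) → Σ[ m ] (λ k → f (csuc k)) ≈ Σ[ m ] f
  Σ-csuc zero    f = refl
  Σ-csuc (suc M) f = begin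
    Σ[ suc M ] (λ k → f (csuc k))             ≈⟨ Σ-orbit (λ k → f (csuc k)) Fin.zero ⟨
    Σ<[ suc M ] (λ t → f (csuc (Fin.zero ⊕ t))) ≈⟨ Σ<-cong (suc M) (λ t _ → reflexive (≡.cong f (⊕-suc Fin.zero t))) ⟨
    Σ<[ suc M ] (λ t → f (csuc Fin.zero ⊕ t))   ≈⟨ Σ-orbit f (csuc Fin.zero) ⟩
    Σ[ suc M ] f                              ∎

  Σ-pairs<ᵇ : ∀ m (G : ℕ → Carrier) → Σ<[ m ] (λ s → Σ<[ m ] (λ t → if s <ᵇ t then G s * G t else 0#)) ≈ e₂ m G
  Σ-pairs<ᵇ m G = begin
    Σ<[ m ] (λ s → Σ<[ m ] (λ t → B s t))       ≈⟨ Σ-comm m m (λ s t → B (toℕ s) (toℕ t)) ⟩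
    Σ<[ m ] (λ t → Σ<[ m ] (λ s → B s t))       ≈⟨ Σ<-cong m (λ t t<m → Σ<-below t m (λ s → G s * G t) (<⇒≤ t<m)) ⟩
    Σ<[ m ] (λ t → Σ<[ t ] (λ s → G s * G t))   ≈⟨ Σ<-cong m (λ t _ → *-distribʳ-Σ t (G t) (λ s → G (toℕ s))) ⟨
    e₂ m G                                      ∎
    where
    B : ℕ → ℕ → Carrier
    B s t = if s <ᵇ t then G s * G t else 0#
    Σ<-below : ∀ t m (H : ℕ → Carrier) → t ≤ m → Σ<[ m ] (λ s → if s <ᵇ t then H s else 0#) ≈ Σ<[ t ] H
    Σ<-below zero    m       H _         = Σ-zero m
    Σ<-below (suc t) (suc m) H (s≤s t≤m) = +-congˡ (Σ<-below t m (λ s → H (suc s)) t≤m)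

  e₂-orbit : ∀ {m} (w : Fin m → Carrier) k →
             e₂ m (λ t → w (k ⊕ t)) ≈ Σ[ m ] (λ k → Σ[ m ] (λ l → if toℕ k <ᵇ toℕ l then w k * w l else 0#))
  e₂-orbit {suc M} w k = begin
    e₂ m (λ t → w (k ⊕ t))          ≈⟨ orbit-invariant w (e₂ m) shift k ⟩
    e₂ m (λ t → w (Fin.zero ⊕ t))   ≈⟨ Σ-pairs<ᵇ m (λ t → w (Fin.zero ⊕ t)) ⟨
    Σ<[ m ] (λ s → Σ<[ m ] (λ t → if s <ᵇ t then w (Fin.zero ⊕ s) * w (Fin.zero ⊕ t) else 0#))
      ≈⟨ Σ-cong m (λ k → Σ-cong m (λ l → reflexive
           (≡.cong₂ (λ a b → if toℕ k <ᵇ toℕ l then w a * w b else 0#) (zero⊕toℕ k) (zero⊕toℕ l)))) ⟩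
    Σ[ m ] (λ k → Σ[ m ] (λ l → if toℕ k <ᵇ toℕ l then w k * w l else 0#)) ∎
    where
    m = suc M
    shift : ∀ k → e₂ m (λ t → w (csuc k ⊕ t)) ≈ e₂ m (λ t → w (k ⊕ t))
    shift k = e₂-shift m (λ t → w (k ⊕ t)) (reflexive (≡.cong w (⊕-period k)))

  Σ-orbit-pred : ∀ {m} (f : Fin m → Carrier) k → Σ<[ pred m ] (λ s → f (k ⊕ s)) + f (k ⊕ pred m) ≈ Σ[ m ] f
  Σ-orbit-pred {suc M} f k = trans (sym (Σ<-snoc M (λ s → f (k ⊕ s)))) (Σ-orbit f k)

module DifferenceQuotients {c ℓ} (R : CommutativeRing c ℓ) where
  open CommutativeRing R
  open RingProperties ring using (-‿distribʳ-*; //-rightDividesˡ; //-rightDividesʳ; -‿+-comm)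
  open import Relation.Binary.Reasoning.Setoid setoid

  x≈b+y⇒c[x-y]≈bc-1+1 : ∀ {x y} b c → x ≈ b + y → c * (x - y) ≈ b * c - 1# + 1#
  x≈b+y⇒c[x-y]≈bc-1+1 {x} {y} b c x≈b+y = begin
    c * (x - y)        ≈⟨ *-congˡ (+-congʳ x≈b+y) ⟩
    c * ((b + y) - y)  ≈⟨ *-congˡ (//-rightDividesʳ y b) ⟩
    c * b              ≈⟨ *-comm c b ⟩
    b * c              ≈⟨ //-rightDividesˡ 1# (b * c) ⟨
    b * c - 1# + 1#    ∎

  y≈a+x⇒c[x-y]≈bc-1+0 : ∀ {x y} a b c → y ≈ a + x → (a + b) * c ≈ 1# → c * (x - y) ≈ b * c - 1# + 0#
  y≈a+x⇒c[x-y]≈bc-1+0 {x} {y} a b c y≈a+x [a+b]c≈1 = begin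
    c * (x - y)                 ≈⟨ *-congˡ (+-congˡ (-‿cong y≈a+x)) ⟩
    c * (x - (a + x))           ≈⟨ *-congˡ (x-[a+x]≈-a a x) ⟩
    c * - a                     ≈⟨ -‿distribʳ-* c a ⟨
    - (c * a)                   ≈⟨ x-[a+x]≈-a (c * a) (b * c) ⟨
    b * c - (c * a + b * c)     ≈⟨ +-congˡ (-‿cong (trans (+-congʳ (*-comm c a)) (trans (sym (distribʳ c a b)) [a+b]c≈1))) ⟩
    b * c - 1#                  ≈⟨ +-identityʳ _ ⟨
    b * c - 1# + 0#             ∎
    where
    x-[a+x]≈-a : ∀ a x → x - (a + x) ≈ - a
    x-[a+x]≈-a a x = begin
      x - (a + x)      ≈⟨ +-congˡ (-‿+-comm a x) ⟨
      x + (- a - x)    ≈⟨ +-congˡ (+-comm (- a) (- x)) ⟩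
      x + (- x + - a)  ≈⟨ +-assoc x (- x) (- a) ⟨
      (x - x) + - a    ≈⟨ +-congʳ (-‿inverseʳ x) ⟩
      0# + - a         ≈⟨ +-identityˡ (- a) ⟩
      - a              ∎

  invertible-zero⇒trivial : ∀ {w c} → w * c ≈ 1# → w ≈ 0# → ∀ x → x ≈ 0#
  invertible-zero⇒trivial {w} {c} wc≈1 w≈0 x = begin
    x             ≈⟨ *-identityʳ x ⟨
    x * 1#        ≈⟨ *-congˡ wc≈1 ⟨
    x * (w * c)   ≈⟨ *-congˡ (trans (*-congʳ w≈0) (zeroˡ c)) ⟩
    x * 0#        ≈⟨ zeroʳ x ⟩
    0#            ∎

module Matrices {c ℓ} (R : CommutativeRing c ℓ) (n : ℕ) where
  open CommutativeRing R
  open Cactoid R using (Σ[_]; _⊗_; Id)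
  open Sums R
  open import Relation.Binary.Reasoning.Setoid setoid

  Matrix : Set c
  Matrix = Fin n → Fin n → Carrier

  Id≈χ : ∀ (u v : Fin n) → Id u v ≈ χ (u ≟ᶠ v)
  Id≈χ u v with u ≟ᶠ v
  ... | yes _ = refl
  ... | no  _ = refl

  Σ-Id*ˡ : ∀ (u : Fin n) (g : Fin n → Carrier) → Σ[ n ] (λ v → Id u v * g v) ≈ g u
  Σ-Id*ˡ u g = trans (Σ-cong n (λ v → *-congʳ (Id≈χ u v))) (Σ-δ n u g)

  Σ-*Idʳ : ∀ (v : Fin n) (g : Fin n → Carrier) → Σ[ n ] (λ u → g u * Id u v) ≈ g v
  Σ-*Idʳ v g = trans (Σ-cong n (λ u → trans (*-comm _ _) (*-congʳ (Id≈χ u v)))) (Σ-δ′ n v g)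

  Σ-Id-row : ∀ (u : Fin n) → Σ[ n ] (λ v → Id u v) ≈ 1#
  Σ-Id-row u = trans (Σ-cong n (λ v → sym (*-identityʳ _))) (Σ-Id*ˡ u (λ _ → 1#))

  Σ-Id-column : ∀ (v : Fin n) → Σ[ n ] (λ u → Id u v) ≈ 1#
  Σ-Id-column v = trans (Σ-cong n (λ u → sym (*-identityˡ _))) (Σ-*Idʳ v (λ _ → 1#))

  Σ-⊗*ʳ : ∀ (M N : Matrix) x (g : Fin n → Carrier) →
          Σ[ n ] (λ u → (M ⊗ N) x u * g u) ≈ Σ[ n ] (λ y → M x y * Σ[ n ] (λ u → N y u * g u))
  Σ-⊗*ʳ M N x g = begin
    Σ[ n ] (λ u → Σ[ n ] (λ y → M x y * N y u) * g u)      ≈⟨ Σ-cong n (λ u → *-distribʳ-Σ n (g u) _) ⟩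
    Σ[ n ] (λ u → Σ[ n ] (λ y → M x y * N y u * g u))      ≈⟨ Σ-comm n n _ ⟩
    Σ[ n ] (λ y → Σ[ n ] (λ u → M x y * N y u * g u))      ≈⟨ Σ-cong n (λ y → trans (Σ-cong n (λ u → *-assoc _ _ _)) (sym (*-distribˡ-Σ n _ _))) ⟩
    Σ[ n ] (λ y → M x y * Σ[ n ] (λ u → N y u * g u))      ∎

  Σ-rows-⊗ : ∀ (M N : Matrix) u → Σ[ n ] (λ v → (M ⊗ N) u v) ≈ Σ[ n ] (λ x → M u x * Σ[ n ] (λ v → N x v))
  Σ-rows-⊗ M N u = trans (Σ-cong n (λ v → sym (*-identityʳ _)))
                         (trans (Σ-⊗*ʳ M N u (λ _ → 1#)) (Σ-cong n (λ x → *-congˡ (Σ-cong n (λ v → *-identityʳ _)))))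

  Σ-columns-⊗ : ∀ (M N : Matrix) v → Σ[ n ] (λ u → (M ⊗ N) u v) ≈ Σ[ n ] (λ x → Σ[ n ] (λ u → M u x) * N x v)
  Σ-columns-⊗ M N v = trans (Σ-comm n n _) (Σ-cong n (λ x → sym (*-distribʳ-Σ n (N x v) _)))

module Walks {c ℓ} (R : CommutativeRing c ℓ) {n} (D : Cactoid.WeightedCycles R n) where
  open CommutativeRing R using (_≈_; _+_; +-identityˡ; +-assoc; +-congˡ) renaming (refl to ≈-refl; sym to ≈-sym; trans to ≈-trans)
  open Cactoid R
  open WeightedCycles D
  open import Data.List.Membership.DecPropositional (_≟ᶠ_ {n}) using (_∈?_)

  infixr 5 _++ʷ_

  _++ʷ_ : ∀ {u w v} → Walk D u w → Walk D w v → Walk D u v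
  []       ++ʷ q = q
  (ik ∷ p) ++ʷ q = ik ∷ (p ++ʷ q)

  sources : ∀ {u v} → Walk D u v → List (Fin n)
  sources []       = []
  sources (ik ∷ p) = vert (proj₁ ik) (proj₂ ik) ∷ sources p

  vertices : ∀ {u v} → Walk D u v → List (Fin n)
  vertices = walkVertices D

  vertices-++ : ∀ {u w v} (p : Walk D u w) (q : Walk D w v) → vertices (p ++ʷ q) ≡ sources p ++ vertices q
  vertices-++ []       q = ≡.refl
  vertices-++ (ik ∷ p) q = ≡.cong (_ ∷_) (vertices-++ p q)

  vertices≡sources++[last] : ∀ {u v} (p : Walk D u v) → vertices p ≡ sources p ++ [ v ]
  vertices≡sources++[last] []       = ≡.refl
  vertices≡sources++[last] (ik ∷ p) = ≡.cong (_ ∷_) (vertices≡sources++[last] p)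

  first∈vertices : ∀ {u v} (p : Walk D u v) → u ∈ vertices p
  first∈vertices []      = here ≡.refl
  first∈vertices (_ ∷ _) = here ≡.refl

  last∈vertices : ∀ {u v} (p : Walk D u v) → v ∈ vertices p
  last∈vertices []       = here ≡.refl
  last∈vertices (_ ∷ p) = there (last∈vertices p)

  sources⊆vertices : ∀ {u v z} (p : Walk D u v) → z ∈ sources p → z ∈ vertices p
  sources⊆vertices (_ ∷ p) (here e)  = here e
  sources⊆vertices (_ ∷ p) (there z∈) = there (sources⊆vertices p z∈)

  ∈-++ʷ⁺ˡ : ∀ {u w v z} (p : Walk D u w) (q : Walk D w v) → z ∈ vertices p → z ∈ vertices (p ++ʷ q)
  ∈-++ʷ⁺ˡ []      q (here ≡.refl) = first∈vertices q
  ∈-++ʷ⁺ˡ (_ ∷ p) q (here e)      = here e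
  ∈-++ʷ⁺ˡ (_ ∷ p) q (there z∈)    = there (∈-++ʷ⁺ˡ p q z∈)

  walkWeight-++ : ∀ {u w v} (p : Walk D u w) (q : Walk D w v) →
                  walkWeight D (p ++ʷ q) ≈ walkWeight D p + walkWeight D q
  walkWeight-++ []       q = ≈-sym (+-identityˡ _)
  walkWeight-++ (ik ∷ p) q = ≈-trans (+-congˡ (walkWeight-++ p q)) (≈-sym (+-assoc _ _ _))

  splitAt : ∀ {u v z} (p : Walk D u v) → z ∈ vertices p → Σ (Walk D u z) λ s → Σ (Walk D z v) λ t → p ≡ s ++ʷ t
  splitAt []       (here ≡.refl) = [] , [] , ≡.refl
  splitAt (ik ∷ p) (here ≡.refl) = [] , ik ∷ p , ≡.refl
  splitAt (ik ∷ p) (there z∈) with splitAt p z∈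
  ... | s , t , ≡.refl = ik ∷ s , t , ≡.refl

  IsPath-++⁻ˡ : ∀ {u w v} (p : Walk D u w) (q : Walk D w v) → IsPath D (p ++ʷ q) → IsPath D p
  IsPath-++⁻ˡ []       q _          = [] ∷ []
  IsPath-++⁻ˡ (ik ∷ p) q (x∉ ∷ pq) = All.tabulate (All.lookup x∉ ∘ ∈-++ʷ⁺ˡ p q) ∷ IsPath-++⁻ˡ p q pq

  IsPath-++⁻ʳ : ∀ {u w v} (p : Walk D u w) (q : Walk D w v) → IsPath D (p ++ʷ q) → IsPath D q
  IsPath-++⁻ʳ p q pq = unique-++⁻ʳ (sources p) (≡.subst Unique (vertices-++ p q) pq)

  IsPath-++⁺ : ∀ {u w v} (p : Walk D u w) (q : Walk D w v) →
               IsPath D p → IsPath D q → Disjoint (sources p) (vertices q) → IsPath D (p ++ʷ q)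
  IsPath-++⁺ p q pp qp disjoint = ≡.subst Unique (≡.sym (vertices-++ p q))
    (Unique.++⁺ (unique-++⁻ˡ (sources p) (≡.subst Unique (vertices≡sources++[last] p) pp)) qp disjoint)

  reach⇒walk : ∀ {u v} → Reach (Arc D) u v → Walk D u v
  reach⇒walk here                             = []
  reach⇒walk (step (i , k , ≡.refl , ≡.refl) r) = (i , k) ∷ reach⇒walk r

  -- prepend an arc to a path, cutting off the cycle it may close
  _∷ᵖ_ : ∀ {v} ik → Σ (Walk D (vert (proj₁ ik) (csuc (proj₂ ik))) v) (IsPath D) →
         Σ (Walk D (vert (proj₁ ik) (proj₂ ik)) v) (IsPath D)
  ik ∷ᵖ (p , p-path) with vert (proj₁ ik) (proj₂ ik) ∈? vertices p
  ... | no  u∉ = ik ∷ p , ¬Any⇒All¬ _ u∉ ∷ p-path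
  ... | yes u∈ = let (s , t , p≡s++t) = splitAt p u∈ in
                 t , IsPath-++⁻ʳ s t (≡.subst (IsPath D) p≡s++t p-path)

  walk⇒path : ∀ {u v} → Walk D u v → Σ (Walk D u v) (IsPath D)
  walk⇒path []       = [] , [] ∷ []
  walk⇒path (ik ∷ p) = ik ∷ᵖ walk⇒path p

  firstCycle : ∀ {u v} → Walk D u v → Maybe (Fin r)
  firstCycle []       = nothing
  firstCycle (ik ∷ _) = just (proj₁ ik)

  lastCycle : ∀ {u v} → Walk D u v → Maybe (Fin r)
  lastCycle []       = nothing
  lastCycle (ik ∷ p) = lastCycle p <∣> just (proj₁ ik)

  data ArcOf : ∀ {u v} → Walk D u v → Fin n → Fin n → Set where
    first : ∀ {v} ik (p : Walk D (vert (proj₁ ik) (csuc (proj₂ ik))) v) →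
            ArcOf (ik ∷ p) (vert (proj₁ ik) (proj₂ ik)) (vert (proj₁ ik) (csuc (proj₂ ik)))
    later : ∀ {v a b} ik {p : Walk D (vert (proj₁ ik) (csuc (proj₂ ik))) v} → ArcOf p a b → ArcOf (ik ∷ p) a b

  ArcOf⇒Arc : ∀ {u v a b} {p : Walk D u v} → ArcOf p a b → Arc D a b
  ArcOf⇒Arc (first (i , k) p) = i , k , ≡.refl , ≡.refl
  ArcOf⇒Arc (later _ a→b)     = ArcOf⇒Arc a→b

  ArcOf⇒source∈ : ∀ {u v a b} {p : Walk D u v} → ArcOf p a b → a ∈ vertices p
  ArcOf⇒source∈ (first _ p)   = here ≡.refl
  ArcOf⇒source∈ (later _ a→b) = there (ArcOf⇒source∈ a→b)

  ArcOf⇒target∈ : ∀ {u v a b} {p : Walk D u v} → ArcOf p a b → b ∈ vertices p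
  ArcOf⇒target∈ (first _ p)   = there (first∈vertices p)
  ArcOf⇒target∈ (later _ a→b) = there (ArcOf⇒target∈ a→b)

  data SnocView : ∀ {u v} → Walk D u v → Set where
    []   : ∀ {u} → SnocView ([] {u = u})
    _∷ʳ_ : ∀ {u} jm (s : Walk D u (vert (proj₁ jm) (proj₂ jm))) → SnocView (s ++ʷ jm ∷ [])

  snocView : ∀ {u v} (p : Walk D u v) → SnocView p
  snocView []       = []
  snocView (ik ∷ p) with snocView p
  ... | []      = ik ∷ʳ []
  ... | jm ∷ʳ s = jm ∷ʳ (ik ∷ s)

  lastCycle-++ : ∀ {u w v j} (s : Walk D u w) {t : Walk D w v} → lastCycle t ≡ just j → lastCycle (s ++ʷ t) ≡ just j
  lastCycle-++ []       e = e
  lastCycle-++ (ik ∷ s) e = ≡.cong (_<∣> just (proj₁ ik)) (lastCycle-++ s e)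

  lastCycle-∷ʳ : ∀ {u} jm (s : Walk D u (vert (proj₁ jm) (proj₂ jm))) → lastCycle (s ++ʷ jm ∷ []) ≡ just (proj₁ jm)
  lastCycle-∷ʳ jm s = lastCycle-++ s ≡.refl

  ArcOf-∷ʳ : ∀ {u} jm (s : Walk D u (vert (proj₁ jm) (proj₂ jm))) →
             ArcOf (s ++ʷ jm ∷ []) (vert (proj₁ jm) (proj₂ jm)) (vert (proj₁ jm) (csuc (proj₂ jm)))
  ArcOf-∷ʳ jm []       = first jm []
  ArcOf-∷ʳ jm (ik ∷ s) = later ik (ArcOf-∷ʳ jm s)

  firstCycle-++ : ∀ {u w v j} (s : Walk D u w) (t : Walk D w v) → firstCycle s ≡ just j → firstCycle (s ++ʷ t) ≡ just j
  firstCycle-++ (ik ∷ s) t e = e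

  IsPath-loop : ∀ {u} (p : Walk D u u) → IsPath D p → p ≡ []
  IsPath-loop []       _          = ≡.refl
  IsPath-loop (ik ∷ p) (u∉p ∷ _) = ⊥-elim (All.lookup u∉p (last∈vertices p) ≡.refl)

  firstCycle-≢ : ∀ {u v} (p : Walk D u v) → u ≢ v → Σ (Fin r) λ j → firstCycle p ≡ just j
  firstCycle-≢ []            u≢v = ⊥-elim (u≢v ≡.refl)
  firstCycle-≢ ((j , _) ∷ _) _   = j , ≡.refl

  lastCycle-≢ : ∀ {u v} (p : Walk D u v) → u ≢ v → Σ (Fin r) λ j → lastCycle p ≡ just j
  lastCycle-≢ p u≢v with snocView p
  ... | []           = ⊥-elim (u≢v ≡.refl)
  ... | (j , m) ∷ʳ s = j , lastCycle-∷ʳ (j , m) s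

  firstCycle⇒∈ : ∀ {u v i} (p : Walk D u v) → firstCycle p ≡ just i → Σ (Fin (size i)) λ k → vert i k ≡ u
  firstCycle⇒∈ ((_ , k) ∷ _) ≡.refl = k , ≡.refl

  lastCycle⇒∈ : ∀ {u v i} (p : Walk D u v) → lastCycle p ≡ just i → Σ (Fin (size i)) λ l → vert i l ≡ v
  lastCycle⇒∈ p last≡i with snocView p
  ... | [] with last≡i
  ...   | ()
  lastCycle⇒∈ p last≡i | (j , m) ∷ʳ s with ≡.trans (≡.sym (lastCycle-∷ʳ (j , m) s)) last≡i
  ... | ≡.refl = csuc m , ≡.refl

module Segments {c ℓ} (R : CommutativeRing c ℓ) {n} (D : Cactoid.WeightedCycles R n) where
  open CommutativeRing R using (_≈_; _+_; setoid)
  open Cactoid R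
  open WeightedCycles D
  open Sums R using (Σ<[_]; Σ-orbit-pred)
  open import Relation.Binary.Reasoning.Setoid setoid
  open Walks R D

  segment : ∀ i k t → Walk D (vert i k) (vert i (k ⊕ t))
  segment i k zero    = []
  segment i k (suc t) = (i , k) ∷ segment i (csuc k) t

  segment-weight : ∀ i k t → walkWeight D (segment i k t) ≡ Σ<[ t ] (λ s → wt i (k ⊕ s))
  segment-weight i k zero    = ≡.refl
  segment-weight i k (suc t) = ≡.cong (wt i k +_) (segment-weight i (csuc k) t)

  ∈-segment⁻ : ∀ i k t {z} → z ∈ vertices (segment i k t) → Σ ℕ λ s → s ≤ t × z ≡ vert i (k ⊕ s)
  ∈-segment⁻ i k zero    (here e)  = 0 , z≤n , e
  ∈-segment⁻ i k (suc t) (here e)  = 0 , z≤n , e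
  ∈-segment⁻ i k (suc t) (there z∈) with ∈-segment⁻ i (csuc k) t z∈
  ... | s , s≤t , e = suc s , s≤s s≤t , e

  ∈-sources-segment⁻ : ∀ i k t {z} → z ∈ sources (segment i k t) → Σ ℕ λ s → s < t × z ≡ vert i (k ⊕ s)
  ∈-sources-segment⁻ i k (suc t) (here e)  = 0 , s≤s z≤n , e
  ∈-sources-segment⁻ i k (suc t) (there z∈) with ∈-sources-segment⁻ i (csuc k) t z∈
  ... | s , s<t , e = suc s , s≤s s<t , e

  ∈-segment⁺ : ∀ i k {t s} → s ≤ t → vert i (k ⊕ s) ∈ vertices (segment i k t)
  ∈-segment⁺ i k {zero}  {zero}  _         = here ≡.refl
  ∈-segment⁺ i k {suc t} {zero}  _         = here ≡.refl
  ∈-segment⁺ i k {suc t} {suc s} (s≤s s≤t) = there (∈-segment⁺ i (csuc k) s≤t)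

  ArcOf-segment : ∀ i k {t s} → s < t → ArcOf (segment i k t) (vert i (k ⊕ s)) (vert i (csuc (k ⊕ s)))
  ArcOf-segment i k {suc t} {zero}  _         = first (i , k) (segment i (csuc k) t)
  ArcOf-segment i k {suc t} {suc s} (s≤s s<t) = later (i , k) (ArcOf-segment i (csuc k) s<t)

  segment-isPath : ∀ i k t → t < size i → IsPath D (segment i k t)
  segment-isPath i k zero    _       = [] ∷ []
  segment-isPath i k (suc t) 1+t<m   =
    All.tabulate k∉ ∷ segment-isPath i (csuc k) t (≤-trans (n≤1+n _) 1+t<m)
    where
    k∉ : ∀ {z} → z ∈ vertices (segment i (csuc k) t) → vert i k ≢ z
    k∉ z∈ k≡z with ∈-segment⁻ i (csuc k) t z∈
    ... | s , s≤t , z≡ with ⊕-injective k (≤-trans (s≤s z≤n) 1+t<m) (≤-<-trans (s≤s s≤t) 1+t<m)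
                                          (vert-inj i (≡.trans k≡z z≡))
    ...   | ()

  -- Gᵢ without its arc vᵢₖ → vᵢₖ₊₁
  around : ∀ i k → Walk D (vert i (csuc k)) (vert i k)
  around i k = ≡.subst (Walk D (vert i (csuc k))) (≡.cong (vert i) (csuc⊕pred k)) (segment i (csuc k) (pred (size i)))

  around-preserves : ∀ {p} i k (P : ∀ {v} → Walk D (vert i (csuc k)) v → Set p) →
                     P (segment i (csuc k) (pred (size i))) → P (around i k)
  around-preserves i k P = go (≡.cong (vert i) (csuc⊕pred k))
    where
    go : ∀ {v} (e : vert i (csuc k ⊕ pred (size i)) ≡ v) → P (segment i (csuc k) (pred (size i))) →
         P (≡.subst (Walk D (vert i (csuc k))) e (segment i (csuc k) (pred (size i))))
    go ≡.refl Pseg = Pseg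

  around-isPath : ∀ i k → IsPath D (around i k)
  around-isPath i k = around-preserves i k (IsPath D) (segment-isPath i (csuc k) _ (pred<m k))

  ∈-around : ∀ i k t → vert i t ∈ vertices (around i k)
  ∈-around i k t = around-preserves i k (λ p → vert i t ∈ vertices p)
    (≡.subst (λ l → vert i l ∈ vertices (segment i (csuc k) (pred (size i)))) (⊕-offset (csuc k) t)
             (∈-segment⁺ i (csuc k) (<⇒≤pred (offset<m (csuc k) t))))
    where
    <⇒≤pred : ∀ {s m} → s < m → s ≤ pred m
    <⇒≤pred (s≤s s≤m) = s≤m

  ArcOf-around : ∀ i k t → t ≢ k → ArcOf (around i k) (vert i t) (vert i (csuc t))
  ArcOf-around i k t t≢k = around-preserves i k (λ p → ArcOf p (vert i t) (vert i (csuc t)))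
    (≡.subst (λ l → ArcOf (segment i (csuc k) (pred (size i))) (vert i l) (vert i (csuc l))) (⊕-offset (csuc k) t)
             (ArcOf-segment i (csuc k) (<∧≢⇒<pred (offset<m (csuc k) t) s≢pred)))
    where
    s≢pred : offset (csuc k) t ≢ pred (size i)
    s≢pred s≡ = t≢k (≡.trans (≡.sym (⊕-offset (csuc k) t)) (≡.trans (≡.cong (csuc k ⊕_) s≡) (csuc⊕pred k)))
    <∧≢⇒<pred : ∀ {s m} → s < m → s ≢ pred m → s < pred m
    <∧≢⇒<pred (s≤s s≤m) s≢m = ≤∧≢⇒< s≤m s≢m

  ∈-sources-around⁻ : ∀ i k {z} → z ∈ sources (around i k) → (Σ (Fin (size i)) λ t → vert i t ≡ z) × z ≢ vert i k
  ∈-sources-around⁻ i k {z} = around-preserves i k (λ p → z ∈ sources p → (Σ (Fin (size i)) λ t → vert i t ≡ z) × z ≢ vert i k) onSegment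
    where
    m = size i
    onSegment : z ∈ sources (segment i (csuc k) (pred m)) → (Σ (Fin m) λ t → vert i t ≡ z) × z ≢ vert i k
    onSegment z∈ with ∈-sources-segment⁻ i (csuc k) (pred m) z∈
    ... | s , s<pred , z≡ = (csuc k ⊕ s , ≡.sym z≡) , λ z≡k → <-irrefl
          (⊕-injective (csuc k) (<-trans s<pred (pred<m k)) (pred<m k)
             (≡.trans (vert-inj i (≡.trans (≡.sym z≡) z≡k)) (≡.sym (csuc⊕pred k)))) s<pred

  segment-pred-weight : ∀ i l → walkWeight D (segment i l (pred (size i))) + wt i (l ⊕ pred (size i)) ≈ w₁ D i
  segment-pred-weight i l = begin
    walkWeight D (segment i l (pred (size i))) + wt i (l ⊕ pred (size i))  ≡⟨ ≡.cong (_+ _) (segment-weight i l (pred (size i))) ⟩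
    Σ<[ pred (size i) ] (λ s → wt i (l ⊕ s)) + wt i (l ⊕ pred (size i))   ≈⟨ Σ-orbit-pred (wt i) l ⟩
    w₁ D i                                                                ∎

  around-weight : ∀ i k → walkWeight D (around i k) + wt i k ≈ w₁ D i
  around-weight i k = begin
    walkWeight D (around i k) + wt i k
      ≡⟨ ≡.cong₂ _+_ (around-preserves i k (λ p → walkWeight D p ≡ walkWeight D (segment i (csuc k) (pred (size i)))) ≡.refl)
                     (≡.cong (wt i) (≡.sym (csuc⊕pred k))) ⟩
    walkWeight D (segment i (csuc k) (pred (size i))) + wt i (csuc k ⊕ pred (size i))
      ≈⟨ segment-pred-weight i (csuc k) ⟩
    w₁ D i
      ∎

module Ears {c ℓ} (R : CommutativeRing c ℓ) {n} (D : Cactoid.WeightedCycles R n) where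
  open Cactoid R
  open WeightedCycles D
  open Walks R D
  open Digraph (Arc D)

  -- Avoiding (A H) x is by definition the arc relation of the undirected graph underlying delete H x
  Avoiding : (Fin n → Fin n → Set) → Fin n → Fin n → Fin n → Set
  Avoiding B x a b = (B a b × a ≢ x × b ≢ x) ⊎ (B b a × b ≢ x × a ≢ x)

  Avoiding-sym : ∀ {B x a b} → Avoiding B x a b → Avoiding B x b a
  Avoiding-sym (inj₁ e) = inj₂ e
  Avoiding-sym (inj₂ e) = inj₁ e

  Avoiding-map : ∀ {B C : Fin n → Fin n → Set} {x} → (∀ {a b} → B a b → C a b) → ∀ {a b} → Avoiding B x a b → Avoiding C x a b
  Avoiding-map f (inj₁ (e , a≢ , b≢)) = inj₁ (f e , a≢ , b≢)
  Avoiding-map f (inj₂ (e , b≢ , a≢)) = inj₂ (f e , b≢ , a≢)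

  along⁺ : ∀ {u v z} (p : Walk D u v) → z ∈ vertices p → Reach (ArcOf p) z v
  along⁺ []       (here ≡.refl) = here
  along⁺ (ik ∷ p) (here ≡.refl) = step (first ik p) (Reach-map (later ik) (along⁺ p (first∈vertices p)))
  along⁺ (ik ∷ p) (there z∈)    = Reach-map (later ik) (along⁺ p z∈)

  along⁻ : ∀ {u v z} (p : Walk D u v) → z ∈ vertices p → Reach (ArcOf p) u z
  along⁻ []       (here ≡.refl) = here
  along⁻ (ik ∷ p) (here ≡.refl) = here
  along⁻ (ik ∷ p) (there z∈)    = step (first ik p) (Reach-map (later ik) (along⁻ p z∈))

  along⁺-avoiding : ∀ {u v z x} (p : Walk D u v) → All (_≢ x) (vertices p) → z ∈ vertices p →
                    Reach (Avoiding (ArcOf p) x) z v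
  along⁺-avoiding []       _            (here ≡.refl) = here
  along⁺-avoiding (ik ∷ p) (u≢x ∷ p≢x) (here ≡.refl) =
    step (inj₁ (first ik p , u≢x , All.lookup p≢x (first∈vertices p)))
         (Reach-map (Avoiding-map (later ik)) (along⁺-avoiding p p≢x (first∈vertices p)))
  along⁺-avoiding (ik ∷ p) (_ ∷ p≢x)   (there z∈)     = Reach-map (Avoiding-map (later ik)) (along⁺-avoiding p p≢x z∈)

  toEndpoint : ∀ {u v z x} (p : Walk D u v) → IsPath D p → z ∈ vertices p → z ≢ x →
               (Reach (Avoiding (ArcOf p) x) z u × u ≢ x) ⊎ (Reach (Avoiding (ArcOf p) x) z v × v ≢ x)
  toEndpoint []       _ (here ≡.refl) z≢x = inj₁ (here , z≢x)
  toEndpoint (ik ∷ p) _ (here ≡.refl) z≢x = inj₁ (here , z≢x)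
  toEndpoint {x = x} (ik ∷ p) (u∉p ∷ p-path) (there z∈) z≢x with toEndpoint p p-path z∈ z≢x
  ... | inj₂ (r , v≢x) = inj₂ (Reach-map (Avoiding-map (later ik)) r , v≢x)
  ... | inj₁ (r , w≢x) with vert (proj₁ ik) (proj₂ ik) ≟ᶠ x
  ...   | no  u≢x    = inj₁ (Reach-∷ʳ (Reach-map (Avoiding-map (later ik)) r) (inj₂ (first ik p , u≢x , w≢x)) , u≢x)
  ...   | yes ≡.refl = inj₂ (Reach-map (Avoiding-map (later ik)) (along⁺-avoiding p p≢x z∈) , All.lookup p≢x (last∈vertices p))
    where
    p≢x : All (_≢ x) (vertices p)
    p≢x = All.map (_∘ ≡.sym) u∉p

  module _ (H : Subgraph) {x y : Fin n} (q : Walk D x y) where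

    H∪q : Subgraph
    H∪q = record
      { V     = λ z → V H z ⊎ z ∈ vertices q
      ; A     = λ a b → A H a b ⊎ ArcOf q a b
      ; A⊆Arc = λ { (inj₁ e) → A⊆Arc H e ; (inj₂ e) → ArcOf⇒Arc e }
      ; A⊆V   = λ { (inj₁ e) → inj₁ (proj₁ (A⊆V H e)) , inj₁ (proj₂ (A⊆V H e))
                  ; (inj₂ e) → inj₂ (ArcOf⇒source∈ e) , inj₂ (ArcOf⇒target∈ e) }
      }

    module _ (H-blockLike : BlockLike H) (q-path : IsPath D q) (x∈H : V H x) (y∈H : V H y) (x≢y : x ≢ y) where
      private
        H-strong : StronglyConnected H
        H-strong = proj₁ H-blockLike
        H-noCut : ∀ x′ → ¬ CutVertex H x′
        H-noCut = proj₂ (proj₂ H-blockLike)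

      H∪q-strong : StronglyConnected H∪q
      H∪q-strong u v (inj₁ u∈) (inj₁ v∈) = Reach-map inj₁ (H-strong u v u∈ v∈)
      H∪q-strong u v (inj₁ u∈) (inj₂ v∈) = Reach-trans (Reach-map inj₁ (H-strong u x u∈ x∈H)) (Reach-map inj₂ (along⁻ q v∈))
      H∪q-strong u v (inj₂ u∈) (inj₁ v∈) = Reach-trans (Reach-map inj₂ (along⁺ q u∈)) (Reach-map inj₁ (H-strong y v y∈H v∈))
      H∪q-strong u v (inj₂ u∈) (inj₂ v∈) =
        Reach-trans (Reach-map inj₂ (along⁺ q u∈)) (Reach-trans (Reach-map inj₁ (H-strong y x y∈H x∈H)) (Reach-map inj₂ (along⁻ q v∈)))

      -- H∪q − x′ is connected once some connected G ⊆ H∪q − x′ contains every vertex of H but x′: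
      -- the vertices of q reach x or y inside q
      module _ (x′ : Fin n) (G : Fin n → Set) (H⊆G : ∀ z → V H z → z ≢ x′ → G z) where

        reach-G : ∀ z → V H∪q z → z ≢ x′ → Σ (Fin n) λ g → G g × Reach (Avoiding (A H∪q) x′) z g
        reach-G z (inj₁ z∈H) z≢x′ = z , H⊆G z z∈H z≢x′ , here
        reach-G z (inj₂ z∈q) z≢x′ with toEndpoint q q-path z∈q z≢x′
        ... | inj₁ (z→x , x≢x′) = x , H⊆G x x∈H x≢x′ , Reach-map (Avoiding-map {ArcOf q} {A H∪q} inj₂) z→x
        ... | inj₂ (z→y , y≢x′) = y , H⊆G y y∈H y≢x′ , Reach-map (Avoiding-map {ArcOf q} {A H∪q} inj₂) z→y

        connected-via : (∀ a b → G a → G b → Reach (Avoiding (A H∪q) x′) a b) → WeaklyConnected (delete H∪q x′)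
        connected-via G-connected u v (u∈ , u≢x′) (v∈ , v≢x′) with reach-G u u∈ u≢x′ | reach-G v v∈ v≢x′
        ... | g , g∈G , u→g | g′ , g′∈G , v→g′ =
          Reach-trans u→g (Reach-trans (G-connected g g′ g∈G g′∈G) (Reach-reverse Avoiding-sym v→g′))

      H∪q-noCut : ∀ x′ → ¬ CutVertex H∪q x′
      H∪q-noCut x′ (_ , disconnected) = excluded-middle λ
        { (inj₁ x′∈H) → H-noCut x′ (x′∈H , λ H-x′-connected → disconnected
            (connected-via x′ (λ z → V H z × z ≢ x′) (λ z z∈ z≢x′ → z∈ , z≢x′)
               (λ a b a∈ b∈ → Reach-map (Avoiding-map {A H} {A H∪q} inj₁) (H-x′-connected a b a∈ b∈))))
        ; (inj₂ x′∉H) → disconnected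
            (connected-via x′ (V H) (λ z z∈ _ → z∈)
               (λ a b a∈ b∈ → Reach-map (λ e → inj₁ (inj₁ e , avoids x′∉H e)) (H-strong a b a∈ b∈)))
        }
        where
        -- membership in H is not decidable, but the goal ⊥ is stable under double negation
        excluded-middle : ¬ ¬ (V H x′ ⊎ ¬ V H x′)
        excluded-middle k = k (inj₂ (k ∘ inj₁))
        avoids : ¬ V H x′ → ∀ {a b} → A H a b → a ≢ x′ × b ≢ x′
        avoids x′∉H e = (λ { ≡.refl → x′∉H (proj₁ (A⊆V H e)) }) , (λ { ≡.refl → x′∉H (proj₂ (A⊆V H e)) })

      H∪q-blockLike : BlockLike H∪q
      H∪q-blockLike = H∪q-strong , twoVertices , H∪q-noCut
        where
        twoVertices : AtLeastTwoVertices H∪q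
        twoVertices with proj₁ (proj₂ H-blockLike)
        ... | a , b , a∈ , b∈ , a≢b = a , b , inj₁ a∈ , inj₁ b∈ , a≢b

module Cactoids {c ℓ} (R : CommutativeRing c ℓ) {n} (D : Cactoid.WeightedCycles R n)
                (cactoid : Cactoid.IsCactoidWithBlocks R D) where
  open Cactoid R
  open WeightedCycles D
  open Walks R D
  open Segments R D
  open Ears R D
  open Digraph (Arc D)

  private
    cycle-isBlock : ∀ i → IsBlock (cycleSub D i)
    cycle-isBlock = proj₁ (proj₂ cactoid)

  ear⊆cycle : ∀ i {x y} (q : Walk D x y) → IsPath D q → V (cycleSub D i) x → V (cycleSub D i) y → x ≢ y →
              H∪q (cycleSub D i) q ⊆ cycleSub D i
  ear⊆cycle i q q-path x∈ y∈ x≢y = proj₂ (cycle-isBlock i) (H∪q (cycleSub D i) q)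
    (H∪q-blockLike (cycleSub D i) q (proj₁ (cycle-isBlock i)) q-path x∈ y∈ x≢y)
    ((λ _ → inj₁) , (λ _ _ → inj₁))

  arc-determines-cycle : ∀ i j k m → vert i k ≡ vert j m → vert i (csuc k) ≡ vert j (csuc m) → i ≡ j
  arc-determines-cycle i j k m tails≡ heads≡ = proj₂ (proj₂ (proj₂ cactoid)) i j (Gᵢ⊆Gⱼ , Gⱼ⊆Gᵢ)
    where
    -- the rest of Gⱼ is an ear of Gᵢ
    Gⱼ∖arc⊆Gᵢ : H∪q (cycleSub D i) (around j m) ⊆ cycleSub D i
    Gⱼ∖arc⊆Gᵢ = ear⊆cycle i (around j m) (around-isPath j m) (csuc k , heads≡) (k , tails≡)
                  (λ e → csuc≢id (size≥2 j) m (vert-inj j e))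
    Gⱼ⊆Gᵢ : cycleSub D j ⊆ cycleSub D i
    Gⱼ⊆Gᵢ = (λ { _ (t , ≡.refl) → proj₁ Gⱼ∖arc⊆Gᵢ _ (inj₂ (∈-around j m t)) })
          , (λ { _ _ (t , ≡.refl , ≡.refl) → arc t })
      where
      arc : ∀ t → A (cycleSub D i) (vert j t) (vert j (csuc t))
      arc t with t ≟ᶠ m
      ... | yes ≡.refl = k , tails≡ , heads≡
      ... | no  t≢m    = proj₂ Gⱼ∖arc⊆Gᵢ _ _ (inj₂ (ArcOf-around j m t t≢m))
    Gᵢ⊆Gⱼ : cycleSub D i ⊆ cycleSub D j
    Gᵢ⊆Gⱼ = proj₂ (cycle-isBlock j) (cycleSub D i) (proj₁ (cycle-isBlock i)) Gⱼ⊆Gᵢ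

  first-arc-on-cycle : ∀ i {u z} (s : Walk D u z) → IsPath D s → V (cycleSub D i) u → V (cycleSub D i) z → u ≢ z →
                       firstCycle s ≡ just i
  first-arc-on-cycle i [] _ _ _ u≢z = ⊥-elim (u≢z ≡.refl)
  first-arc-on-cycle i ((j , m) ∷ s) s-path u∈ z∈ u≢z
    with proj₂ (ear⊆cycle i ((j , m) ∷ s) s-path u∈ z∈ u≢z) _ _ (inj₂ (first (j , m) s))
  ... | t , tails≡ , heads≡ = ≡.cong just (≡.sym (arc-determines-cycle i j t m tails≡ heads≡))

  last-arc-on-cycle : ∀ i {z v} (t : Walk D z v) → IsPath D t → V (cycleSub D i) z → V (cycleSub D i) v → z ≢ v →
                      lastCycle t ≡ just i
  last-arc-on-cycle i t t-path z∈ v∈ z≢v with snocView t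
  ... | []              = ⊥-elim (z≢v ≡.refl)
  ... | (j , m) ∷ʳ s with proj₂ (ear⊆cycle i (s ++ʷ (j , m) ∷ []) t-path z∈ v∈ z≢v) _ _ (inj₂ (ArcOf-∷ʳ (j , m) s))
  ...   | l , tails≡ , heads≡ =
    ≡.trans (lastCycle-∷ʳ (j , m) s) (≡.cong just (≡.sym (arc-determines-cycle i j l m tails≡ heads≡)))

  meets-cycle-only-at-start : ∀ {u v} (p : Walk D u v) → IsPath D p → ∀ i → V (cycleSub D i) u → firstCycle p ≢ just i →
                              ∀ {z} → z ∈ vertices p → V (cycleSub D i) z → z ≡ u
  meets-cycle-only-at-start {u} p p-path i u∈ first≢i {z} z∈p z∈Gᵢ with z ≟ᶠ u
  ... | yes z≡u = z≡u
  ... | no  z≢u with splitAt p z∈p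
  ... | s , t , ≡.refl = ⊥-elim (first≢i (firstCycle-++ s t
                           (first-arc-on-cycle i s (IsPath-++⁻ˡ s t p-path) u∈ z∈Gᵢ (z≢u ∘ ≡.sym))))

  meets-cycle-only-at-end : ∀ {u v} (p : Walk D u v) → IsPath D p → ∀ i → V (cycleSub D i) v → lastCycle p ≢ just i →
                            ∀ {z} → z ∈ vertices p → V (cycleSub D i) z → z ≡ v
  meets-cycle-only-at-end {v = v} p p-path i v∈ last≢i {z} z∈p z∈Gᵢ with z ≟ᶠ v
  ... | yes z≡v = z≡v
  ... | no  z≢v with splitAt p z∈p
  ... | s , t , ≡.refl = ⊥-elim (last≢i (lastCycle-++ s
                           (last-arc-on-cycle i t (IsPath-++⁻ʳ s t p-path) z∈Gᵢ v∈ z≢v)))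

module Distances {c ℓ} (R : CommutativeRing c ℓ) {n} (D : Cactoid.WeightedCycles R n)
                 (cactoid : Cactoid.IsCactoidWithBlocks R D)
                 (W : Fin n → Fin n → CommutativeRing.Carrier R) (W-distance : Cactoid.IsDistanceMatrix R D W) where
  open CommutativeRing R
  open Cactoid R
  open WeightedCycles D
  open Walks R D
  open Segments R D
  open Cactoids R D cactoid
  open import Relation.Binary.Reasoning.Setoid setoid

  path : ∀ u v → Walk D u v
  path u v = proj₁ (walk⇒path (reach⇒walk (proj₁ cactoid u v tt tt)))

  path-isPath : ∀ u v → IsPath D (path u v)
  path-isPath u v = proj₂ (walk⇒path (reach⇒walk (proj₁ cactoid u v tt tt)))

  W-diagonal : ∀ u → W u u ≈ 0#
  W-diagonal u = W-distance u u [] ([] ∷ [])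

  W≈weight : ∀ {u v} (p : Walk D u v) → IsPath D p → W u v ≈ walkWeight D p
  W≈weight p = W-distance _ _ p

  W-leaving-along : ∀ {u v} i k → vert i k ≡ u → (p : Walk D u v) → IsPath D p → firstCycle p ≡ just i →
                    W u v ≈ wt i k + W (vert i (csuc k)) v
  W-leaving-along i k k≡u ((i , m) ∷ p) p-path@(_ ∷ tail-path) ≡.refl with vert-inj i k≡u
  ... | ≡.refl = trans (W≈weight ((i , k) ∷ p) p-path) (+-congˡ (sym (W≈weight p tail-path)))

  W-leaving-off : ∀ {v} i k (p : Walk D (vert i k) v) → IsPath D p → firstCycle p ≢ just i →
                  W (vert i (csuc k)) v ≈ walkWeight D (around i k) + W (vert i k) v
  W-leaving-off {v} i k p p-path first≢i = begin
    W (vert i (csuc k)) v                      ≈⟨ W≈weight (around i k ++ʷ p) detour-isPath ⟩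
    walkWeight D (around i k ++ʷ p)            ≈⟨ walkWeight-++ (around i k) p ⟩
    walkWeight D (around i k) + walkWeight D p ≈⟨ +-congˡ (W≈weight p p-path) ⟨
    walkWeight D (around i k) + W (vert i k) v ∎
    where
    detour-isPath : IsPath D (around i k ++ʷ p)
    detour-isPath = IsPath-++⁺ (around i k) p (around-isPath i k) p-path λ (z∈around , z∈p) →
      let (z∈Gᵢ , z≢vₖ) = ∈-sources-around⁻ i k z∈around
      in z≢vₖ (meets-cycle-only-at-start p p-path i (k , ≡.refl) first≢i z∈p z∈Gᵢ)

  W-entering-along : ∀ {u v} i l → vert i l ≡ v → (p : Walk D u v) → IsPath D p → lastCycle p ≡ just i →
                     W u v ≈ W u (vert i (cpred l)) + wt i (cpred l)
  W-entering-along {u} i l l≡v p p-path last≡i with snocView p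
  ... | [] with last≡i
  ...   | ()
  W-entering-along {u} i l l≡v p p-path last≡i | (j , m) ∷ʳ s with ≡.trans (≡.sym (lastCycle-∷ʳ (j , m) s)) last≡i
  ... | ≡.refl with vert-inj i l≡v
  ...   | ≡.refl = begin
    W u (vert i (csuc m))                                    ≈⟨ W≈weight (s ++ʷ (i , m) ∷ []) p-path ⟩
    walkWeight D (s ++ʷ (i , m) ∷ [])                        ≈⟨ walkWeight-++ s ((i , m) ∷ []) ⟩
    walkWeight D s + (wt i m + 0#)                           ≈⟨ +-cong (sym (W≈weight s (IsPath-++⁻ˡ s _ p-path))) (+-identityʳ _) ⟩
    W u (vert i m) + wt i m                                  ≡⟨ ≡.cong (λ x → W u (vert i x) + wt i x) (cpred-csuc m) ⟨
    W u (vert i (cpred (csuc m))) + wt i (cpred (csuc m))    ∎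

  W-entering-off : ∀ {u v} i l → vert i l ≡ v → (p : Walk D u v) → IsPath D p → lastCycle p ≢ just i →
                   ∀ t → t < size i → W u (vert i (l ⊕ t)) ≈ W u v + walkWeight D (segment i l t)
  W-entering-off {u} {v} i l ≡.refl p p-path last≢i t t<m = begin
    W u (vert i (l ⊕ t))                             ≈⟨ W≈weight (p ++ʷ segment i l t) continuation-isPath ⟩
    walkWeight D (p ++ʷ segment i l t)               ≈⟨ walkWeight-++ p (segment i l t) ⟩
    walkWeight D p + walkWeight D (segment i l t)    ≈⟨ +-congʳ (W≈weight p p-path) ⟨
    W u v + walkWeight D (segment i l t)             ∎
    where
    v∉sources : ∀ {z} → z ∈ sources p → z ≢ v
    v∉sources z∈ z≡v = unique-++⇒disjoint (sources p) (≡.subst Unique (vertices≡sources++[last] p) p-path)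
                         (z∈ , here z≡v)
    continuation-isPath : IsPath D (p ++ʷ segment i l t)
    continuation-isPath = IsPath-++⁺ p (segment i l t) p-path (segment-isPath i l t t<m) λ (z∈p , z∈seg) →
      let (s , _ , z≡) = ∈-segment⁻ i l t z∈seg
      in v∉sources z∈p (meets-cycle-only-at-end p p-path i (l , ≡.refl) last≢i (sources⊆vertices p z∈p) (l ⊕ s , ≡.sym z≡))

module BlockMatrices {c ℓ} (R : CommutativeRing c ℓ) {n} (D : Cactoid.WeightedCycles R n)
              (inv : Fin (Cactoid.WeightedCycles.r D) → CommutativeRing.Carrier R) where
  open CommutativeRing R
  open RingProperties ring using ([y-z]x≈yx-zx)
  open Cactoid R
  open WeightedCycles D
  open Sums R
  open import Relation.Binary.Reasoning.Setoid setoid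

  extend : (i : Fin r) → (Fin (size i) → Carrier) → Fin n → Carrier
  extend i f = atVertex D inv i f 0#

  L̂ : Fin r → Fin n → Fin n → Carrier
  L̂ i u x = extend i (λ k → extend i (Lᵢ D inv i k) x) u

  extend-cong : ∀ i {f g} v → (∀ k → f k ≈ g k) → extend i f v ≈ extend i g v
  extend-cong i v f≈g with any? (λ l → vert i l ≟ᶠ v)
  ... | yes (k , _) = f≈g k
  ... | no  _       = refl

  extend-zero : ∀ i v → extend i (λ _ → 0#) v ≈ 0#
  extend-zero i v with any? (λ l → vert i l ≟ᶠ v)
  ... | yes _ = refl
  ... | no  _ = refl

  extend-δ : ∀ i f x → extend i f x ≈ Σ[ size i ] (λ l → χ (vert i l ≟ᶠ x) * f l)
  extend-δ i f x with any? (λ l → vert i l ≟ᶠ x)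
  ... | yes (k , ≡.refl) = sym (trans (Σ-cong (size i) (λ l → *-congʳ (χ-cong (vert i l ≟ᶠ vert i k) (l ≟ᶠ k) (vert-inj i) (≡.cong (vert i)))))
                                      (Σ-δ′ (size i) k f))
  ... | no  x∉           = sym (trans (Σ-cong (size i) off) (Σ-zero (size i)))
    where
    off : ∀ l → χ (vert i l ≟ᶠ x) * f l ≈ 0#
    off l with vert i l ≟ᶠ x
    ... | yes vₗ≡x = ⊥-elim (x∉ (l , vₗ≡x))
    ... | no  _    = zeroˡ _

  Σ-extend : ∀ i f (g : Fin n → Carrier) → Σ[ n ] (λ x → extend i f x * g x) ≈ Σ[ size i ] (λ l → f l * g (vert i l))
  Σ-extend i f g = begin
    Σ[ n ] (λ x → extend i f x * g x)
      ≈⟨ Σ-cong n (λ x → trans (*-congʳ (extend-δ i f x)) (*-distribʳ-Σ (size i) (g x) _)) ⟩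
    Σ[ n ] (λ x → Σ[ size i ] (λ l → χ (vert i l ≟ᶠ x) * f l * g x))
      ≈⟨ Σ-comm n (size i) _ ⟩
    Σ[ size i ] (λ l → Σ[ n ] (λ x → χ (vert i l ≟ᶠ x) * f l * g x))
      ≈⟨ Σ-cong (size i) (λ l → trans (Σ-cong n (λ x → *-assoc _ _ _)) (Σ-δ n (vert i l) (λ x → f l * g x))) ⟩
    Σ[ size i ] (λ l → f l * g (vert i l))
      ∎

  Σ-extendʳ : ∀ i f (g : Fin n → Carrier) → Σ[ n ] (λ x → g x * extend i f x) ≈ Σ[ size i ] (λ l → g (vert i l) * f l)
  Σ-extendʳ i f g = trans (Σ-cong n (λ x → *-comm _ _)) (trans (Σ-extend i f g) (Σ-cong (size i) (λ l → *-comm _ _)))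

  Lᵢ≈χ : ∀ i k l → Lᵢ D inv i k l ≈ inv i * (χ (k ≟ᶠ l) - χ (l ≟ᶠ csuc k))
  Lᵢ≈χ i k l with k ≟ᶠ l | l ≟ᶠ csuc k
  ... | yes _ | yes _ = refl
  ... | yes _ | no  _ = refl
  ... | no  _ | yes _ = refl
  ... | no  _ | no  _ = refl

  Lᵢ*≈χ : ∀ i k l a → Lᵢ D inv i k l * a ≈ inv i * (χ (k ≟ᶠ l) * a - χ (l ≟ᶠ csuc k) * a)
  Lᵢ*≈χ i k l a = trans (*-congʳ (Lᵢ≈χ i k l)) (trans (*-assoc _ _ _) (*-congˡ ([y-z]x≈yx-zx _ _ _)))

  Lᵢ-row : ∀ i k (h : Fin (size i) → Carrier) → Σ[ size i ] (λ l → Lᵢ D inv i k l * h l) ≈ inv i * (h k - h (csuc k))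
  Lᵢ-row i k h = begin
    Σ[ m ] (λ l → Lᵢ D inv i k l * h l)                              ≈⟨ Σ-cong m (λ l → Lᵢ*≈χ i k l (h l)) ⟩
    Σ[ m ] (λ l → inv i * (χ (k ≟ᶠ l) * h l - χ (l ≟ᶠ csuc k) * h l)) ≈⟨ *-distribˡ-Σ m (inv i) _ ⟨
    inv i * Σ[ m ] (λ l → χ (k ≟ᶠ l) * h l - χ (l ≟ᶠ csuc k) * h l)   ≈⟨ *-congˡ (trans (Σ-sub m _ _) (+-cong (Σ-δ m k h) (-‿cong (Σ-δ′ m (csuc k) h)))) ⟩
    inv i * (h k - h (csuc k))                                      ∎
    where m = size i

  Lᵢ-column : ∀ i l (h : Fin (size i) → Carrier) → Σ[ size i ] (λ k → h k * Lᵢ D inv i k l) ≈ inv i * (h l - h (cpred l))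
  Lᵢ-column i l h = begin
    Σ[ m ] (λ k → h k * Lᵢ D inv i k l)                              ≈⟨ Σ-cong m (λ k → trans (*-comm _ _) (Lᵢ*≈χ i k l (h k))) ⟩
    Σ[ m ] (λ k → inv i * (χ (k ≟ᶠ l) * h k - χ (l ≟ᶠ csuc k) * h k)) ≈⟨ *-distribˡ-Σ m (inv i) _ ⟨
    inv i * Σ[ m ] (λ k → χ (k ≟ᶠ l) * h k - χ (l ≟ᶠ csuc k) * h k)   ≈⟨ *-congˡ (trans (Σ-sub m _ _) (+-cong (Σ-δ′ m l h) (-‿cong Σ-pred))) ⟩
    inv i * (h l - h (cpred l))                                      ∎
    where
    m = size i
    Σ-pred : Σ[ m ] (λ k → χ (l ≟ᶠ csuc k) * h k) ≈ h (cpred l)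
    Σ-pred = trans (Σ-cong m (λ k → *-congʳ (χ-cong (l ≟ᶠ csuc k) (k ≟ᶠ cpred l)
                     (λ l≡csuc-k → ≡.trans (≡.sym (cpred-csuc k)) (≡.cong cpred (≡.sym l≡csuc-k)))
                     (λ k≡cpred-l → ≡.trans (≡.sym (csuc-cpred l)) (≡.cong csuc (≡.sym k≡cpred-l))))))
                   (Σ-δ′ m (cpred l) h)

  L̂-row : ∀ i u (g : Fin n → Carrier) →
          Σ[ n ] (λ x → L̂ i u x * g x) ≈ extend i (λ k → inv i * (g (vert i k) - g (vert i (csuc k)))) u
  L̂-row i u g with any? (λ k → vert i k ≟ᶠ u)
  ... | yes (k , ≡.refl) = trans (Σ-extend i (Lᵢ D inv i k) g) (Lᵢ-row i k (λ l → g (vert i l)))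
  ... | no  _            = trans (Σ-cong n (λ x → zeroˡ (g x))) (Σ-zero n)

  L̂-column : ∀ i v (g : Fin n → Carrier) →
             Σ[ n ] (λ x → g x * L̂ i x v) ≈ extend i (λ l → inv i * (g (vert i l) - g (vert i (cpred l)))) v
  L̂-column i v g with any? (λ k → vert i k ≟ᶠ v)
  ... | yes (l , ≡.refl) = trans (Σ-extendʳ i (λ k → Lᵢ D inv i k l) g) (Lᵢ-column i l (λ k → g (vert i k)))
  ... | no  _            = trans (Σ-cong n (λ x → trans (*-congˡ (extend-zero i x)) (zeroʳ (g x)))) (Σ-zero n)

  extend-affine : ∀ i f (e : Fin n → Carrier) v → ((∀ k → vert i k ≢ v) → e v ≈ 0#) →
               extend i (λ k → f k - 1# + e (vert i k)) v ≈ extend i f v - extend i (λ _ → 1#) v + e v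
  extend-affine i f e v e-off with any? (λ k → vert i k ≟ᶠ v)
  ... | yes (k , ≡.refl) = refl
  ... | no  v∉           = sym (trans (+-cong (-‿inverseʳ 0#) (e-off (λ k vₖ≡v → v∉ (k , vₖ≡v)))) (+-identityʳ 0#))

module DistanceMatrixIdentities {c ℓ} (R : CommutativeRing c ℓ) {n} (D : Cactoid.WeightedCycles R n)
            (cactoid : Cactoid.IsCactoidWithBlocks R D)
            (inv : Fin (Cactoid.WeightedCycles.r D) → CommutativeRing.Carrier R)
            (inv-correct : ∀ i → CommutativeRing._≈_ R (CommutativeRing._*_ R (Cactoid.w₁ R D i) (inv i)) (CommutativeRing.1# R))
            (W : Fin n → Fin n → CommutativeRing.Carrier R) (W-distance : Cactoid.IsDistanceMatrix R D W) where
  open CommutativeRing R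
  open Cactoid R
  open WeightedCycles D
  open Sums R
  open Walks R D
  open Segments R D
  open Distances R D cactoid W W-distance
  open BlockMatrices R D inv
  open DifferenceQuotients R
  open RingProperties ring using (quasigroup; -‿distribˡ-*; -‿distribʳ-*; x[y-z]≈xy-xz; //-rightDividesˡ; //-rightDividesʳ; -0#≈0#)
  open import Algebra.Properties.Quasigroup quasigroup using (x≈z//y) renaming (cancelʳ to +-cancelʳ)
  open import Algebra.Solver.Ring.NaturalCoefficients.Default commutativeSemiring using (solve; _:*_; _:=_)
  open import Relation.Binary.Reasoning.Setoid setoid

  _≟ᴹ_ : DecidableEquality (Maybe (Fin r))
  _≟ᴹ_ = ≡-decᴹ _≟ᶠ_

  leaves enters : Fin r → Fin n → Fin n → Carrier
  leaves i u v = χ (firstCycle (path u v) ≟ᴹ just i)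
  enters i u v = χ (lastCycle (path u v) ≟ᴹ just i)

  Σ-χ+Id : ∀ (u v : Fin n) (c : Maybe (Fin r)) → (u ≡ v → c ≡ nothing) → (u ≢ v → Σ (Fin r) λ j → c ≡ just j) →
           Σ[ r ] (λ i → χ (c ≟ᴹ just i)) + Id u v ≈ 1#
  Σ-χ+Id u v c loop⇒nothing step⇒just with u ≟ᶠ v
  ... | yes u≡v rewrite loop⇒nothing u≡v = trans (+-congʳ (Σ-zero r)) (+-identityˡ 1#)
  ... | no  u≢v with step⇒just u≢v
  ...   | j , ≡.refl = trans (+-identityʳ _) (trans (Σ-cong r χ≈δ) (Σ-δ r j (λ _ → 1#)))
    where
    χ≈δ : ∀ i → χ (just j ≟ᴹ just i) ≈ χ (j ≟ᶠ i) * 1#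
    χ≈δ i = trans (χ-cong (just j ≟ᴹ just i) (j ≟ᶠ i) just-injective (≡.cong just)) (sym (*-identityʳ _))

  Σ-leaves : ∀ u v → Σ[ r ] (λ i → leaves i u v) + Id u v ≈ 1#
  Σ-leaves u v = Σ-χ+Id u v (firstCycle (path u v))
    (λ { ≡.refl → ≡.cong firstCycle (IsPath-loop (path u u) (path-isPath u u)) })
    (firstCycle-≢ (path u v))

  Σ-enters : ∀ u v → Σ[ r ] (λ i → enters i u v) + Id u v ≈ 1#
  Σ-enters u v = Σ-χ+Id u v (lastCycle (path u v))
    (λ { ≡.refl → ≡.cong lastCycle (IsPath-loop (path u u) (path-isPath u u)) })
    (lastCycle-≢ (path u v))

  leaves-off : ∀ i u v → (∀ k → vert i k ≢ u) → leaves i u v ≈ 0#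
  leaves-off i u v u∉ with firstCycle (path u v) ≟ᴹ just i
  ... | yes first≡i = ⊥-elim (let (k , vₖ≡u) = firstCycle⇒∈ (path u v) first≡i in u∉ k vₖ≡u)
  ... | no  _       = refl

  enters-off : ∀ i u v → (∀ l → vert i l ≢ v) → enters i u v ≈ 0#
  enters-off i u v v∉ with lastCycle (path u v) ≟ᴹ just i
  ... | yes last≡i = ⊥-elim (let (l , vₗ≡v) = lastCycle⇒∈ (path u v) last≡i in v∉ l vₗ≡v)
  ... | no  _      = refl

  L̂W-entry : ∀ i k v → inv i * (W (vert i k) v - W (vert i (csuc k)) v) ≈ βᵢ D inv i k - 1# + leaves i (vert i k) v
  L̂W-entry i k v with firstCycle (path (vert i k) v) ≟ᴹ just i
  ... | yes first≡i = x≈b+y⇒c[x-y]≈bc-1+1 (wt i k) (inv i)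
                        (W-leaving-along i k ≡.refl (path _ v) (path-isPath _ v) first≡i)
  ... | no  first≢i = y≈a+x⇒c[x-y]≈bc-1+0 (walkWeight D (around i k)) (wt i k) (inv i)
                        (W-leaving-off i k (path _ v) (path-isPath _ v) first≢i)
                        (trans (*-congʳ (around-weight i k)) (inv-correct i))

  WL̂-entry : ∀ i l u → inv i * (W u (vert i l) - W u (vert i (cpred l))) ≈ αᵢ D inv i l - 1# + enters i u (vert i l)
  WL̂-entry i l u with lastCycle (path u (vert i l)) ≟ᴹ just i
  ... | yes last≡i = x≈b+y⇒c[x-y]≈bc-1+1 (wt i (cpred l)) (inv i)
                       (trans (W-entering-along i l ≡.refl (path u _) (path-isPath u _) last≡i) (+-comm _ _))
  ... | no  last≢i = y≈a+x⇒c[x-y]≈bc-1+0 (walkWeight D (segment i l (pred (size i)))) (wt i (cpred l)) (inv i)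
                       (trans (reflexive (≡.cong (λ x → W u (vert i x)) (cpred≡⊕pred l)))
                              (trans (W-entering-off i l ≡.refl (path u _) (path-isPath u _) last≢i (pred (size i)) (pred<m l))
                                     (+-comm _ _)))
                       (trans (*-congʳ (trans (+-congˡ (reflexive (≡.cong (wt i) (cpred≡⊕pred l)))) (segment-pred-weight i l)))
                              (inv-correct i))

  L̂W-block : ∀ i u v → Σ[ n ] (λ x → L̂ i u x * W x v) ≈ extend i (βᵢ D inv i) u - extend i (λ _ → 1#) u + leaves i u v
  L̂W-block i u v = begin
    Σ[ n ] (λ x → L̂ i u x * W x v)
      ≈⟨ L̂-row i u (λ x → W x v) ⟩
    extend i (λ k → inv i * (W (vert i k) v - W (vert i (csuc k)) v)) u
      ≈⟨ extend-cong i u (λ k → L̂W-entry i k v) ⟩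
    extend i (λ k → βᵢ D inv i k - 1# + leaves i (vert i k) v) u
      ≈⟨ extend-affine i (βᵢ D inv i) (λ x → leaves i x v) u (leaves-off i u v) ⟩
    extend i (βᵢ D inv i) u - extend i (λ _ → 1#) u + leaves i u v
      ∎

  WL̂-block : ∀ i u v → Σ[ n ] (λ x → W u x * L̂ i x v) ≈ extend i (αᵢ D inv i) v - extend i (λ _ → 1#) v + enters i u v
  WL̂-block i u v = begin
    Σ[ n ] (λ x → W u x * L̂ i x v)
      ≈⟨ L̂-column i v (W u) ⟩
    extend i (λ l → inv i * (W u (vert i l) - W u (vert i (cpred l)))) v
      ≈⟨ extend-cong i v (λ l → WL̂-entry i l u) ⟩
    extend i (λ l → αᵢ D inv i l - 1# + enters i u (vert i l)) v
      ≈⟨ extend-affine i (αᵢ D inv i) (enters i u) v (enters-off i u v) ⟩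
    extend i (αᵢ D inv i) v - extend i (λ _ → 1#) v + enters i u v
      ∎

  Σ-affine : ∀ (a b e : Fin r → Carrier) d → Σ[ r ] e + d ≈ 1# →
             Σ[ r ] (λ i → a i - b i + e i) + d ≈ Σ[ r ] a - Σ[ r ] b + 1#
  Σ-affine a b e d Σe+d≈1 = begin
    Σ[ r ] (λ i → a i - b i + e i) + d      ≈⟨ +-congʳ (trans (Σ-+ r _ e) (+-congʳ (Σ-sub r a b))) ⟩
    Σ[ r ] a - Σ[ r ] b + Σ[ r ] e + d      ≈⟨ +-assoc _ _ _ ⟩
    Σ[ r ] a - Σ[ r ] b + (Σ[ r ] e + d)    ≈⟨ +-congˡ Σe+d≈1 ⟩
    Σ[ r ] a - Σ[ r ] b + 1#                ∎

  LW+I≈β : ∀ u v → (L D inv ⊗ W) u v + Id u v ≈ β D inv u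
  LW+I≈β u v = begin
    Σ[ n ] (λ x → L D inv u x * W x v) + Id u v
      ≈⟨ +-congʳ (Σ-cong n (λ x → *-distribʳ-Σ r (W x v) (λ i → L̂ i u x))) ⟩
    Σ[ n ] (λ x → Σ[ r ] (λ i → L̂ i u x * W x v)) + Id u v
      ≈⟨ +-congʳ (trans (Σ-comm n r (λ x i → L̂ i u x * W x v)) (Σ-cong r (λ i → L̂W-block i u v))) ⟩
    Σ[ r ] (λ i → extend i (βᵢ D inv i) u - extend i (λ _ → 1#) u + leaves i u v) + Id u v
      ≈⟨ Σ-affine _ _ (λ i → leaves i u v) (Id u v) (Σ-leaves u v) ⟩
    β D inv u
      ∎

  WL+I≈α : ∀ u v → (W ⊗ L D inv) u v + Id u v ≈ α D inv v
  WL+I≈α u v = begin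
    Σ[ n ] (λ x → W u x * L D inv x v) + Id u v
      ≈⟨ +-congʳ (Σ-cong n (λ x → *-distribˡ-Σ r (W u x) (λ i → L̂ i x v))) ⟩
    Σ[ n ] (λ x → Σ[ r ] (λ i → W u x * L̂ i x v)) + Id u v
      ≈⟨ +-congʳ (trans (Σ-comm n r (λ x i → W u x * L̂ i x v)) (Σ-cong r (λ i → WL̂-block i u v))) ⟩
    Σ[ r ] (λ i → extend i (αᵢ D inv i) v - extend i (λ _ → 1#) v + enters i u v) + Id u v
      ≈⟨ Σ-affine _ _ (λ i → enters i u v) (Id u v) (Σ-enters u v) ⟩
    α D inv v
      ∎

  c[1-1]≈0 : ∀ c → c * (1# - 1#) ≈ 0#
  c[1-1]≈0 c = trans (*-congˡ (-‿inverseʳ 1#)) (zeroʳ c)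

  L-rowSum : ∀ u → Σ[ n ] (λ v → L D inv u v) ≈ 0#
  L-rowSum u = begin
    Σ[ n ] (λ v → Σ[ r ] (λ i → L̂ i u v))           ≈⟨ Σ-comm n r (λ v i → L̂ i u v) ⟩
    Σ[ r ] (λ i → Σ[ n ] (λ v → L̂ i u v))           ≈⟨ Σ-cong r (λ i → trans (Σ-cong n (λ v → sym (*-identityʳ _))) (L̂-row i u (λ _ → 1#))) ⟩
    Σ[ r ] (λ i → extend i (λ _ → inv i * (1# - 1#)) u)  ≈⟨ Σ-cong r (λ i → trans (extend-cong i u (λ _ → c[1-1]≈0 (inv i))) (extend-zero i u)) ⟩
    Σ[ r ] (λ _ → 0#)                                 ≈⟨ Σ-zero r ⟩
    0#                                                ∎

  L-columnSum : ∀ v → Σ[ n ] (λ u → L D inv u v) ≈ 0#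
  L-columnSum v = begin
    Σ[ n ] (λ u → Σ[ r ] (λ i → L̂ i u v))           ≈⟨ Σ-comm n r (λ u i → L̂ i u v) ⟩
    Σ[ r ] (λ i → Σ[ n ] (λ u → L̂ i u v))           ≈⟨ Σ-cong r (λ i → trans (Σ-cong n (λ u → sym (*-identityˡ _))) (L̂-column i v (λ _ → 1#))) ⟩
    Σ[ r ] (λ i → extend i (λ _ → inv i * (1# - 1#)) v)  ≈⟨ Σ-cong r (λ i → trans (extend-cong i v (λ _ → c[1-1]≈0 (inv i))) (extend-zero i v)) ⟩
    Σ[ r ] (λ _ → 0#)                                 ≈⟨ Σ-zero r ⟩
    0#                                                ∎

  -- the path from u meets Gᵢ first at vᵢₖ
  EntersAt : ∀ i → Fin n → Fin (size i) → Set
  EntersAt i u k = lastCycle (path u (vert i k)) ≢ just i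

  Step : ∀ i → Fin n → Fin (size i) → Set ℓ
  Step i u y = W u (vert i (csuc y)) ≈ W u (vert i y) + wt i y

  W-from-entry : ∀ i u x → EntersAt i u x → ∀ t → t < size i →
                 W u (vert i (x ⊕ t)) ≈ W u (vert i x) + Σ<[ t ] (λ s → wt i (x ⊕ s))
  W-from-entry i u x entry t t<m =
    trans (W-entering-off i x ≡.refl (path u _) (path-isPath u _) entry t t<m) (+-congˡ (reflexive (segment-weight i x t)))

  step-after-entry : ∀ i u x → EntersAt i u x → ∀ y → csuc y ≢ x → Step i u y
  step-after-entry i u x entry y =
    ≡.subst (λ y → csuc y ≢ x → Step i u y) (⊕-offset x y) (step-at (offset x y) (offset<m x y))
    where
    G = λ s → wt i (x ⊕ s)
    step-at : ∀ t → t < size i → csuc (x ⊕ t) ≢ x → Step i u (x ⊕ t)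
    step-at t t<m csuc≢x with suc t <? size i
    ... | yes 1+t<m = begin
      W u (vert i (csuc (x ⊕ t)))            ≡⟨ ≡.cong (λ z → W u (vert i z)) (⊕-suc x t) ⟨
      W u (vert i (x ⊕ suc t))               ≈⟨ W-from-entry i u x entry (suc t) 1+t<m ⟩
      W u (vert i x) + Σ<[ suc t ] G         ≈⟨ +-congˡ (Σ<-snoc t G) ⟩
      W u (vert i x) + (Σ<[ t ] G + G t)     ≈⟨ +-assoc _ _ _ ⟨
      W u (vert i x) + Σ<[ t ] G + G t       ≈⟨ +-congʳ (W-from-entry i u x entry t t<m) ⟨
      W u (vert i (x ⊕ t)) + wt i (x ⊕ t)    ∎
    ... | no  1+t≮m = ⊥-elim (csuc≢x (≡.trans (≡.sym (⊕-suc x t))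
                        (≡.trans (≡.cong (x ⊕_) (≤-antisym t<m (≮⇒≥ 1+t≮m))) (⊕-period x))))

  all-steps⇒trivial : ∀ i u → (∀ y → Step i u y) → ∀ x → x ≈ 0#
  all-steps⇒trivial i u steps = invertible-zero⇒trivial (inv-correct i) (+-cancelʳ (Σ[ size i ] d) _ _ (begin
    w₁ D i + Σ[ size i ] d                 ≈⟨ +-comm _ _ ⟩
    Σ[ size i ] d + w₁ D i                 ≈⟨ Σ-+ (size i) d (wt i) ⟨
    Σ[ size i ] (λ y → d y + wt i y)       ≈⟨ Σ-cong (size i) steps ⟨
    Σ[ size i ] (λ y → d (csuc y))         ≈⟨ Σ-csuc (size i) d ⟩
    Σ[ size i ] d                          ≈⟨ +-identityˡ _ ⟨
    0# + Σ[ size i ] d                     ∎))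
    where d = λ k → W u (vert i k)

  -- In a cactoid the path from u meets Gᵢ first at exactly one vertex.  Rather than proving this we observe that
  -- with no such vertex, or with two, every step around Gᵢ is a shortest-path step; these telescope to wᵢ ≈ 0.
  no-entry⇒trivial : ∀ i u → (∀ k → ¬ EntersAt i u k) → ∀ x → x ≈ 0#
  no-entry⇒trivial i u none = all-steps⇒trivial i u λ y →
    trans (W-entering-along i (csuc y) ≡.refl (path u _) (path-isPath u _) (decidable-stable (_ ≟ᴹ just i) (none (csuc y))))
          (reflexive (≡.cong (λ z → W u (vert i z) + wt i z) (cpred-csuc y)))

  two-entries⇒trivial : ∀ i u e k → e ≢ k → EntersAt i u e → EntersAt i u k → ∀ x → x ≈ 0#
  two-entries⇒trivial i u e k e≢k at-e at-k = all-steps⇒trivial i u λ y → case-csuc y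
    where
    case-csuc : ∀ y → Step i u y
    case-csuc y with csuc y ≟ᶠ e
    ... | yes csuc-y≡e = step-after-entry i u k at-k y (λ csuc-y≡k → e≢k (≡.trans (≡.sym csuc-y≡e) csuc-y≡k))
    ... | no  csuc-y≢e = step-after-entry i u e at-e y csuc-y≢e

  Σ-W*wt : ∀ i u e → EntersAt i u e → Σ[ size i ] (λ k → W u (vert i k) * wt i k) ≈ W u (vert i e) * w₁ D i + w₂ D i
  Σ-W*wt i u e entry = begin
    Σ[ m ] (λ k → d k * wt i k)                          ≈⟨ Σ-orbit (λ k → d k * wt i k) e ⟨
    Σ<[ m ] (λ t → d (e ⊕ t) * G t)                      ≈⟨ Σ<-cong m (λ t t<m → *-congʳ {G t} (W-from-entry i u e entry t t<m)) ⟩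
    Σ<[ m ] (λ t → (d e + Σ<[ t ] G) * G t)              ≈⟨ trans (Σ<-cong m (λ t _ → distribʳ (G t) (d e) (Σ<[ t ] G))) (Σ-+ m _ _) ⟩
    Σ<[ m ] (λ t → d e * G t) + e₂ m G                   ≈⟨ +-congʳ (*-distribˡ-Σ m (d e) (λ t → G (toℕ t))) ⟨
    d e * Σ<[ m ] G + e₂ m G                             ≈⟨ +-cong (*-congˡ (Σ-orbit (wt i) e)) (e₂-orbit (wt i) e) ⟩
    d e * w₁ D i + w₂ D i                                ∎
    where
    m = size i
    d = λ k → W u (vert i k)
    G = λ t → wt i (e ⊕ t)

  λ-block : ∀ i u → Σ[ size i ] (λ k → W u (vert i k) * (βᵢ D inv i k - 1# + enters i u (vert i k))) ≈ λᵢ D inv i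
  λ-block i u with any? (λ k → ¬? (lastCycle (path u (vert i k)) ≟ᴹ just i))
  ... | no  no-entry    = trans (trivial _) (sym (trivial _))
    where
    trivial : ∀ x → x ≈ 0#
    trivial = no-entry⇒trivial i u (λ k entry → no-entry (k , entry))
  ... | yes (e , entry) = begin
    Σ[ m ] (λ k → d k * (βᵢ D inv i k - 1# + enters i u (vert i k)))  ≈⟨ Σ-cong m pointwise ⟩
    Σ[ m ] (λ k → d k * βᵢ D inv i k - χ (e ≟ᶠ k) * d k)              ≈⟨ trans (Σ-sub m _ _) (+-congˡ (-‿cong (Σ-δ m e d))) ⟩
    Σ[ m ] (λ k → d k * (wt i k * inv i)) - d e                        ≈⟨ +-congʳ (Σ-cong m (λ k → *-assoc _ _ _)) ⟨
    Σ[ m ] (λ k → d k * wt i k * inv i) - d e                          ≈⟨ +-congʳ (*-distribʳ-Σ m (inv i) _) ⟨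
    Σ[ m ] (λ k → d k * wt i k) * inv i - d e                          ≈⟨ +-congʳ (*-congʳ (Σ-W*wt i u e entry)) ⟩
    (d e * w₁ D i + w₂ D i) * inv i - d e                              ≈⟨ +-congʳ (distribʳ _ _ _) ⟩
    d e * w₁ D i * inv i + λᵢ D inv i - d e                            ≈⟨ +-congʳ (+-congʳ (trans (*-assoc _ _ _) (trans (*-congˡ (inv-correct i)) (*-identityʳ _)))) ⟩
    d e + λᵢ D inv i - d e                                             ≈⟨ +-congʳ (+-comm _ _) ⟩
    λᵢ D inv i + d e - d e                                             ≈⟨ //-rightDividesʳ (d e) (λᵢ D inv i) ⟩
    λᵢ D inv i                                                         ∎
    where
    m = size i
    d = λ k → W u (vert i k)
    pointwise : ∀ k → d k * (βᵢ D inv i k - 1# + enters i u (vert i k)) ≈ d k * βᵢ D inv i k - χ (e ≟ᶠ k) * d k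
    pointwise k with e ≟ᶠ k | lastCycle (path u (vert i k)) ≟ᴹ just i
    ... | yes ≡.refl | yes last≡i = ⊥-elim (entry last≡i)
    ... | yes ≡.refl | no  _      = trans (*-congˡ (+-identityʳ _))
                                      (trans (x[y-z]≈xy-xz _ _ _) (+-congˡ (-‿cong (trans (*-identityʳ _) (sym (*-identityˡ _))))))
    ... | no  _      | yes _      = trans (*-congˡ (//-rightDividesˡ 1# _))
                                      (sym (trans (+-congˡ (trans (-‿cong (zeroˡ _)) -0#≈0#)) (+-identityʳ _)))
    ... | no  e≢k    | no  at-k   = trans (trivial _) (sym (trivial _))
      where
      trivial : ∀ x → x ≈ 0#
      trivial = two-entries⇒trivial i u e k e≢k entry at-k

  W*Id≈0 : ∀ u v → W u v * Id u v ≈ 0#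
  W*Id≈0 u v with u ≟ᶠ v
  ... | yes ≡.refl = trans (*-congʳ (W-diagonal u)) (zeroˡ _)
  ... | no  _      = zeroʳ _

  Wβ≈λ : ∀ u → Σ[ n ] (λ v → W u v * β D inv v) ≈ λ′ D inv
  Wβ≈λ u = begin
    Σ[ n ] (λ v → W u v * β D inv v)                     ≈⟨ Σ-cong n (λ v → *-congˡ (β≈Σh+Id v)) ⟩
    Σ[ n ] (λ v → W u v * (Σ[ r ] (λ i → ĥ i v) + Id u v)) ≈⟨ Σ-cong n W[Σh+Id]≈ΣWh ⟩
    Σ[ n ] (λ v → Σ[ r ] (λ i → W u v * ĥ i v))           ≈⟨ Σ-comm n r _ ⟩
    Σ[ r ] (λ i → Σ[ n ] (λ v → W u v * ĥ i v))           ≈⟨ Σ-cong r (λ i → trans (Σ-extendʳ i (h i) (W u)) (λ-block i u)) ⟩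
    λ′ D inv                                              ∎
    where
    h : ∀ i → Fin (size i) → Carrier
    h i k = βᵢ D inv i k - 1# + enters i u (vert i k)
    ĥ : Fin r → Fin n → Carrier
    ĥ i = extend i (h i)
    β≈Σh+Id : ∀ v → β D inv v ≈ Σ[ r ] (λ i → ĥ i v) + Id u v
    β≈Σh+Id v = sym (trans (+-congʳ (Σ-cong r (λ i → extend-affine i (βᵢ D inv i) (enters i u) v (enters-off i u v))))
                           (Σ-affine _ _ (λ i → enters i u v) (Id u v) (Σ-enters u v)))
    W[Σh+Id]≈ΣWh : ∀ v → W u v * (Σ[ r ] (λ i → ĥ i v) + Id u v) ≈ Σ[ r ] (λ i → W u v * ĥ i v)
    W[Σh+Id]≈ΣWh v = trans (distribˡ _ _ _) (trans (+-congˡ (W*Id≈0 u v)) (trans (+-identityʳ _) (*-distribˡ-Σ r _ _)))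

  open Matrices R n

  Σβ≈1 : Fin n → Σ[ n ] (λ u → β D inv u) ≈ 1#
  Σβ≈1 x₀ = begin
    Σ[ n ] (λ u → β D inv u)                                      ≈⟨ Σ-cong n (λ u → LW+I≈β u x₀) ⟨
    Σ[ n ] (λ u → (L D inv ⊗ W) u x₀ + Id u x₀)                    ≈⟨ Σ-+ n _ _ ⟩
    Σ[ n ] (λ u → (L D inv ⊗ W) u x₀) + Σ[ n ] (λ u → Id u x₀)     ≈⟨ +-cong (Σ-columns-⊗ (L D inv) W x₀) (Σ-Id-column x₀) ⟩
    Σ[ n ] (λ x → Σ[ n ] (λ u → L D inv u x) * W x x₀) + 1#        ≈⟨ +-congʳ (Σ-cong n (λ x → trans (*-congʳ (L-columnSum x)) (zeroˡ _))) ⟩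
    Σ[ n ] (λ _ → 0#) + 1#                                         ≈⟨ trans (+-congʳ (Σ-zero n)) (+-identityˡ 1#) ⟩
    1#                                                             ∎

  Σα≈1 : Fin n → Σ[ n ] (λ v → α D inv v) ≈ 1#
  Σα≈1 x₀ = begin
    Σ[ n ] (λ v → α D inv v)                                      ≈⟨ Σ-cong n (λ v → WL+I≈α x₀ v) ⟨
    Σ[ n ] (λ v → (W ⊗ L D inv) x₀ v + Id x₀ v)                    ≈⟨ Σ-+ n _ _ ⟩
    Σ[ n ] (λ v → (W ⊗ L D inv) x₀ v) + Σ[ n ] (λ v → Id x₀ v)     ≈⟨ +-cong (Σ-rows-⊗ W (L D inv) x₀) (Σ-Id-row x₀) ⟩
    Σ[ n ] (λ x → W x₀ x * Σ[ n ] (λ v → L D inv x v)) + 1#        ≈⟨ +-congʳ (Σ-cong n (λ x → trans (*-congˡ (L-rowSum x)) (zeroʳ _))) ⟩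
    Σ[ n ] (λ _ → 0#) + 1#                                         ≈⟨ trans (+-congʳ (Σ-zero n)) (+-identityˡ 1#) ⟩
    1#                                                             ∎

  -- αᵀ = (W L + I) row x₀, so αᵀ W = (row x₀ of W) (L W + I) = (row x₀ of W) β jᵀ
  αW≈λ : Fin n → ∀ v → Σ[ n ] (λ u → α D inv u * W u v) ≈ λ′ D inv
  αW≈λ x₀ v = begin
    Σ[ n ] (λ u → α D inv u * W u v)
      ≈⟨ Σ-cong n (λ u → *-congʳ (WL+I≈α x₀ u)) ⟨
    Σ[ n ] (λ u → ((W ⊗ L D inv) x₀ u + Id x₀ u) * W u v)
      ≈⟨ trans (Σ-cong n (λ u → distribʳ _ _ _)) (Σ-+ n _ _) ⟩
    Σ[ n ] (λ u → (W ⊗ L D inv) x₀ u * W u v) + Σ[ n ] (λ u → Id x₀ u * W u v)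
      ≈⟨ +-cong (Σ-⊗*ʳ W (L D inv) x₀ (λ u → W u v)) (Σ-Id*ˡ x₀ (λ u → W u v)) ⟩
    Σ[ n ] (λ y → W x₀ y * (L D inv ⊗ W) y v) + W x₀ v
      ≈⟨ +-congʳ (Σ-cong n (λ y → *-congˡ (x≈z//y _ _ _ (LW+I≈β y v)))) ⟩
    Σ[ n ] (λ y → W x₀ y * (β D inv y - Id y v)) + W x₀ v
      ≈⟨ +-congʳ (trans (Σ-cong n (λ y → x[y-z]≈xy-xz _ _ _)) (trans (Σ-sub n _ _) (+-cong (Wβ≈λ x₀) (-‿cong (Σ-*Idʳ v (W x₀)))))) ⟩
    λ′ D inv - W x₀ v + W x₀ v
      ≈⟨ //-rightDividesˡ (W x₀ v) (λ′ D inv) ⟩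
    λ′ D inv
      ∎

  -x+t≈y : ∀ {x y a t} → x + y ≈ a → t ≈ a → - x + t ≈ y
  -x+t≈y {x} {y} {a} {t} x+y≈a t≈a = begin
    - x + t         ≈⟨ +-congˡ (trans t≈a (sym x+y≈a)) ⟩
    - x + (x + y)   ≈⟨ +-assoc _ _ _ ⟨
    (- x + x) + y   ≈⟨ +-congʳ (-‿inverseˡ x) ⟩
    0# + y          ≈⟨ +-identityˡ y ⟩
    y               ∎

  module _ (μ : Carrier) (λμ≈1 : λ′ D inv * μ ≈ 1#) where

    W⁻¹ : Fin n → Fin n → Carrier
    W⁻¹ u v = - L D inv u v + μ * (β D inv u * α D inv v)

    μλ-cancel : ∀ a → μ * a * λ′ D inv ≈ a
    μλ-cancel a = trans (*-congʳ (*-comm μ a)) (trans (*-assoc a μ _) (trans (*-congˡ (trans (*-comm μ _) λμ≈1)) (*-identityʳ a)))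

    W⊗W⁻¹≈Id : ∀ u v → (W ⊗ W⁻¹) u v ≈ Id u v
    W⊗W⁻¹≈Id u v = begin
      Σ[ n ] (λ x → W u x * (- L D inv x v + μ * (β D inv x * α D inv v)))
        ≈⟨ Σ-cong n (λ x → trans (distribˡ _ _ _) (+-cong (sym (-‿distribʳ-* _ _)) (w[m[ba]]≈ma[wb] (W u x) μ (β D inv x) (α D inv v)))) ⟩
      Σ[ n ] (λ x → - (W u x * L D inv x v) + μ * α D inv v * (W u x * β D inv x))
        ≈⟨ trans (Σ-+ n _ _) (+-cong (Σ-neg n _) (sym (*-distribˡ-Σ n _ _))) ⟩
      - (W ⊗ L D inv) u v + μ * α D inv v * Σ[ n ] (λ x → W u x * β D inv x)
        ≈⟨ -x+t≈y (WL+I≈α u v) (trans (*-congˡ (Wβ≈λ u)) (μλ-cancel (α D inv v))) ⟩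
      Id u v
        ∎
      where
      w[m[ba]]≈ma[wb] : ∀ w m b a → w * (m * (b * a)) ≈ m * a * (w * b)
      w[m[ba]]≈ma[wb] = solve 4 (λ w m b a → w :* (m :* (b :* a)) := m :* a :* (w :* b)) refl

    W⁻¹⊗W≈Id : ∀ u v → (W⁻¹ ⊗ W) u v ≈ Id u v
    W⁻¹⊗W≈Id u v = begin
      Σ[ n ] (λ x → (- L D inv u x + μ * (β D inv u * α D inv x)) * W x v)
        ≈⟨ Σ-cong n (λ x → trans (distribʳ _ _ _) (+-cong (sym (-‿distribˡ-* _ _)) ([m[ba]]w≈mb[aw] (W x v) μ (β D inv u) (α D inv x)))) ⟩
      Σ[ n ] (λ x → - (L D inv u x * W x v) + μ * β D inv u * (α D inv x * W x v))
        ≈⟨ trans (Σ-+ n _ _) (+-cong (Σ-neg n _) (sym (*-distribˡ-Σ n _ _))) ⟩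
      - (L D inv ⊗ W) u v + μ * β D inv u * Σ[ n ] (λ x → α D inv x * W x v)
        ≈⟨ -x+t≈y (LW+I≈β u v) (trans (*-congˡ (αW≈λ u v)) (μλ-cancel (β D inv u))) ⟩
      Id u v
        ∎
      where
      [m[ba]]w≈mb[aw] : ∀ w m b a → (m * (b * a)) * w ≈ m * b * (a * w)
      [m[ba]]w≈mb[aw] = solve 4 (λ w m b a → (m :* (b :* a)) :* w := m :* b :* (a :* w)) refl

theorem4p3 : ∀ {c ℓ} (R : CommutativeRing c ℓ) →
    let open CommutativeRing R
        open Cactoid R
    in ∀ {n : ℕ} (D : WeightedCycles n) →
       let open WeightedCycles D in
       1 ≤ n →
       IsCactoidWithBlocks D →
       (inv : Fin r → Carrier) →
       (∀ i → w₁ D i * inv i ≈ 1#) →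
       (W : Fin n → Fin n → Carrier) →
       IsDistanceMatrix D W →
       let α = α D inv
           β = β D inv
           L = L D inv
           lam = λ′ D inv
       in (Σ[ n ] (λ v → α v) ≈ 1#)
          × (∀ u → Σ[ n ] (λ v → L u v) ≈ 0#)
          × (∀ v → Σ[ n ] (λ u → α u * W u v) ≈ lam)
          × (∀ u v → (L ⊗ W) u v + Id u v ≈ β u)
          × (Σ[ n ] (λ v → β v) ≈ 1#)
          × (∀ v → Σ[ n ] (λ u → L u v) ≈ 0#)
          × (∀ u → Σ[ n ] (λ v → W u v * β v) ≈ lam)
          × (∀ u v → (W ⊗ L) u v + Id u v ≈ α v)
          × LaplacianLike L
          × (∀ μ → lam * μ ≈ 1# →
               let M = λ u v → - L u v + μ * (β u * α v)
               in (∀ u v → (W ⊗ M) u v ≈ Id u v) × (∀ u v → (M ⊗ W) u v ≈ Id u v))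
theorem4p3 R {suc n} D (s≤s _) cactoid inv inv-correct W W-distance =
  Σα≈1 x₀ , L-rowSum , αW≈λ x₀ , LW+I≈β , Σβ≈1 x₀ , L-columnSum , Wβ≈λ , WL+I≈α , (L-rowSum , L-columnSum) ,
  λ μ λμ≈1 → W⊗W⁻¹≈Id μ λμ≈1 , W⁻¹⊗W≈Id μ λμ≈1
  where
  open DistanceMatrixIdentities R D cactoid inv inv-correct W W-distance
  x₀ : Fin (suc n)
  x₀ = Fin.zero
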